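{- Let $q\in\mathbb{N}$ and $k\in\mathbb{Z}$ with $\gcd(k,q)=1$ be such that $k/q$ is the value of a normalized Dedekind sum. If $3\nmid q$, then $k\equiv 0\pmod 3$. If $q\equiv 3\pmod 4$, then $k\equiv 2\pmod 4$. If $q\equiv 1\pmod 4$, then $k\equiv 0\pmod 4$.
   Context: For $x\in\mathbb{R}$ let $((x))=x-\lfloor x\rfloor-1/2$ if $x\notin\mathbb{Z}$ and $((x))=0$ if $x\in\mathbb{Z}$. For $a\in\mathbb{Z}$, $b\in\mathbb{N}$ with $\gcd(a,b)=1$, the classical Dedekind sum is $s(a,b)=\sum_{j=1}^{b}((j/b))((aj/b))$, and the normalized Dedekind sum is $S(a,b)=12\,s(a,b)$. A rational number is "the value of a normalized Dedekind sum" if it equals $S(a,b)$ for some such $a,b$. -}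

module Defs where

open import Data.Nat as ℕ using (ℕ; zero; suc)
open import Data.Integer as ℤ using (ℤ; +_)
open import Data.Rational using (ℚ; 0ℚ; ½; _+_; _-_; _*_; floor; _/_)
open import Data.Rational.Properties using (_≟_)
open import Relation.Nullary using (yes; no)
open import Data.Integer.GCD using (gcd)
open import Data.Product using (Σ; _×_)
open import Relation.Binary.PropositionalEquality using (_≡_)

saw : ℚ → ℚ
saw x with (floor x / 1) ≟ x
... | yes _ = 0ℚ
... | no _  = x - (floor x / 1) - ½

sumFrom1 : ℕ → (ℕ → ℚ) → ℚ
sumFrom1 zero    f = 0ℚ
sumFrom1 (suc n) f = sumFrom1 n f + f (suc n)

dedekind : ℤ → (b : ℕ) → .{{_ : ℕ.NonZero b}} → ℚ
dedekind a b = sumFrom1 b (λ j → saw (+ j / b) * saw ((a ℤ.* + j) / b))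

normDedekind : ℤ → (b : ℕ) → .{{_ : ℕ.NonZero b}} → ℚ
normDedekind a b = (+ 12 / 1) * dedekind a b

IsNormDedekindValue : ℚ → Set
IsNormDedekindValue r =
  Σ ℤ λ a → Σ ℕ λ b → Σ (ℕ.NonZero b) λ nz →
    (gcd a (+ b) ≡ + 1) × (normDedekind a b {{nz}} ≡ r)

-- Write r_j = aj mod b and Q_j = ⌊aj/b⌋. Since ((j/b)) ((aj/b)) = (2j − b)(2r_j − b)/4b² for
-- 0 < j < b, S(a,b) = 3W/b² with W = Σ (2j − b)(2r_j − b). As j ↦ r_j permutes 1, …, b − 1, the
-- sums of r_j and r_j² equal those of j and j²; substituting r_j = aj − bQ_j gives integers M and F
-- with 3W = b·M (so M = b·S(a,b)) and a·M = a² + 1 + b·F. If S(a,b) = k/q in lowest terms, then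
-- M q = k b, hence b = Dq, M = kD and a² + 1 = D(ak − qF). So D divides a² + 1: 3 ∤ D, 4 ∤ D, and the
-- odd part of D is ≡ 1 (mod 4) by Fermat's descent. Reducing M = kD modulo 3 gives 3 ∣ k when 3 ∤ q;
-- reducing M = kD (D odd) or a·k·D = a² + 1 + b·F (D even) modulo 4 gives k ≡ q − 1 (mod 4).

module Submission where

open import Data.Bool using (if_then_else_)
open import Data.Integer as ℤ using (ℤ; +_; _+_; _*_; _-_; -_; _%ℕ_; _/ℕ_; ∣_∣)
import Data.Integer.Coprimality as ℤ
open import Data.Integer.DivMod using (a≡a%ℕn+[a/ℕn]*n; n%ℕd<d; div-pos-is-/ℕ)
open import Data.Integer.Divisibility.Signed
  using (_∣_; divides; ∣m∣n⇒∣m+n; ∣m⇒∣-m; ∣n⇒∣m*n; ∣m⇒∣m*n; ∣⇒∣ᵤ; ∣ᵤ⇒∣; ∣-trans;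
         *-cancelˡ-∣; *-monoʳ-∣)
open import Data.Integer.GCD using (gcd)
import Data.Integer.Properties as ℤ
open import Data.Integer.Tactic.RingSolver using (solve-∀)
open import Data.Nat as ℕ using (ℕ; zero; suc; z≤n; s≤s)
import Data.Nat.Coprimality as ℕ
import Data.Nat.Divisibility as ℕ
open import Data.Nat.DivMod using (m≡m%n+[m/n]*n; m/n≤m; m<n⇒m%n≡m; n%n≡0)
open import Data.Nat.Induction using (<-rec)
import Data.Nat.Properties as ℕ
open import Data.Nat.Tactic.RingSolver renaming (solve-∀ to ℕ-solve-∀)
open import Data.Product using (∃-syntax; _×_; _,_; proj₁; proj₂)
open import Data.Rational as ℚ using (ℚ; mkℚ; toℚᵘ)
import Data.Rational.Properties as ℚ
open import Data.Rational.Unnormalised as ℚᵘ using (mkℚᵘ; *≡*; _≃_)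
import Data.Rational.Unnormalised.Properties as ℚᵘ
open import Data.Sum using (_⊎_; inj₁; inj₂)
open import Function using (_∘_)
open import Relation.Binary.Bundles using (Setoid)
open import Relation.Binary.PropositionalEquality
open import Relation.Binary.Structures using (IsEquivalence)
open import Relation.Nullary using (¬_; contradiction; does; yes; no)
open import Relation.Nullary.Decidable using (dec-true; dec-false)

open import Defs

-- Congruences modulo an integer

infix 4 _≡_mod_

-- A record rather than a synonym for m ∣ x - y, so that x and y can be inferred.
record _≡_mod_ (x y m : ℤ) : Set where
  constructor mod∣
  field ∣-difference : m ∣ x - y

module _ {m : ℤ} where

  ≡⇒≡-mod : ∀ {x y} → x ≡ y → x ≡ y mod m
  ≡⇒≡-mod {x} refl = mod∣ (divides (+ 0) (trans (ℤ.+-inverseʳ x) (sym (ℤ.*-zeroˡ m))))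

  ≡-mod-sym : ∀ {x y} → x ≡ y mod m → y ≡ x mod m
  ≡-mod-sym {x} {y} (mod∣ m∣x-y) = mod∣ (subst (m ∣_) (neg-sub x y) (∣m⇒∣-m m∣x-y))
    where
    neg-sub : ∀ x y → - (x - y) ≡ y - x
    neg-sub = solve-∀

  ≡-mod-trans : ∀ {x y z} → x ≡ y mod m → y ≡ z mod m → x ≡ z mod m
  ≡-mod-trans {x} {y} {z} (mod∣ p) (mod∣ q) = mod∣ (subst (m ∣_) (telescope x y z) (∣m∣n⇒∣m+n p q))
    where
    telescope : ∀ x y z → (x - y) + (y - z) ≡ x - z
    telescope = solve-∀

  +-cong-mod : ∀ {x x' y y'} → x ≡ x' mod m → y ≡ y' mod m → x + y ≡ x' + y' mod m
  +-cong-mod {x} {x'} {y} {y'} (mod∣ p) (mod∣ q) = mod∣ (subst (m ∣_) (regroup x x' y y') (∣m∣n⇒∣m+n p q))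
    where
    regroup : ∀ x x' y y' → (x - x') + (y - y') ≡ (x + y) - (x' + y')
    regroup = solve-∀

  *-cong-mod : ∀ {x x' y y'} → x ≡ x' mod m → y ≡ y' mod m → x * y ≡ x' * y' mod m
  *-cong-mod {x} {x'} {y} {y'} (mod∣ p) (mod∣ q) =
    mod∣ (subst (m ∣_) (regroup x x' y y') (∣m∣n⇒∣m+n (∣m⇒∣m*n y p) (∣n⇒∣m*n x' q)))
    where
    regroup : ∀ x x' y y' → (x - x') * y + x' * (y - y') ≡ x * y - x' * y'
    regroup = solve-∀

  *-congˡ-mod : ∀ {x y y'} → y ≡ y' mod m → x * y ≡ x * y' mod m
  *-congˡ-mod {x} = *-cong-mod (≡⇒≡-mod {x = x} refl)

  *-congʳ-mod : ∀ {x x' y} → x ≡ x' mod m → x * y ≡ x' * y mod m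
  *-congʳ-mod {y = y} x≡x' = *-cong-mod x≡x' (≡⇒≡-mod {x = y} refl)

  ≡-mod-scale : ∀ c {x y} → x ≡ y mod m → c * x ≡ c * y mod c * m
  ≡-mod-scale c {x} {y} (mod∣ m∣x-y) = mod∣ (subst (c * m ∣_) (distrib c x y) (*-monoʳ-∣ c m∣x-y))
    where
    distrib : ∀ c x y → c * (x - y) ≡ c * x - c * y
    distrib = solve-∀

  ≡-mod-multiple : ∀ x t → x + t * m ≡ x mod m
  ≡-mod-multiple x t = mod∣ (divides t (cancel x t m))
    where
    cancel : ∀ x t m → (x + t * m) - x ≡ t * m
    cancel = solve-∀

  ≡-mod-isEquivalence : IsEquivalence (_≡_mod m)
  ≡-mod-isEquivalence = record
    { refl  = ≡⇒≡-mod refl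
    ; sym   = ≡-mod-sym
    ; trans = ≡-mod-trans
    }

≡-mod⇒≡+multiple : ∀ {x y m} → x ≡ y mod m → ∃[ t ] x ≡ y + t * m
≡-mod⇒≡+multiple {x} {y} (mod∣ (divides t x-y≡tm)) = t , trans (add-back x y) (cong (λ d → y + d) x-y≡tm)
  where
  add-back : ∀ x y → x ≡ y + (x - y)
  add-back = solve-∀

≡-mod-weaken : ∀ {m m' x y} → m ∣ m' → x ≡ y mod m' → x ≡ y mod m
≡-mod-weaken m∣m' (mod∣ m'∣x-y) = mod∣ (∣-trans m∣m' m'∣x-y)

*-cancelˡ-mod : ∀ c {x y m} .{{_ : ℤ.NonZero c}} → c * x ≡ c * y mod c * m → x ≡ y mod m
*-cancelˡ-mod c {x} {y} (mod∣ p) = mod∣ (*-cancelˡ-∣ c (subst (_ ∣_) (factor c x y) p))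
  where
  factor : ∀ c x y → c * x - c * y ≡ c * (x - y)
  factor = solve-∀

≡-mod-setoid : ℤ → Setoid _ _
≡-mod-setoid m = record { isEquivalence = ≡-mod-isEquivalence {m} }

module ≡-mod-Reasoning (m : ℤ) where
  open import Relation.Binary.Reasoning.Setoid (≡-mod-setoid m) public

multiple≡0-mod : ∀ x m → m * x ≡ + 0 mod m
multiple≡0-mod x m = mod∣ (divides x (trans (ℤ.+-identityʳ (m * x)) (ℤ.*-comm m x)))

coprime-cancel-mod : ∀ {m a x y} → ℤ.Coprime m a → a * x ≡ a * y mod m → x ≡ y mod m
coprime-cancel-mod {m} {a} {x} {y} m⊥a (mod∣ m∣ax-ay) =
  mod∣ (∣ᵤ⇒∣ (ℤ.coprime-divisor m a (x - y) m⊥a (∣⇒∣ᵤ (subst (m ∣_) (factor a x y) m∣ax-ay))))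
  where
  factor : ∀ a x y → a * x - a * y ≡ a * (x - y)
  factor = solve-∀

≡-mod-%ℕ : ∀ x m .{{_ : ℕ.NonZero m}} → x ≡ + (x %ℕ m) mod + m
≡-mod-%ℕ x m = ≡-mod-trans (≡⇒≡-mod (a≡a%ℕn+[a/ℕn]*n x m)) (≡-mod-multiple _ (x /ℕ m))

residue : ∀ x m .{{_ : ℕ.NonZero m}} → ∃[ r ] r ℕ.< m × x ≡ + r mod + m
residue x m = x %ℕ m , n%ℕd<d x m , ≡-mod-%ℕ x m

residue-unique : ∀ {m r s} → + r ≡ + s mod + m → r ℕ.< m → s ℕ.< m → r ≡ s
residue-unique {m} {r} {s} (mod∣ m∣r-s) r<m s<m with ∣ + r - + s ∣ in eq
... | zero  = ℤ.+-injective (ℤ.i-j≡0⇒i≡j (+ r) (+ s) (ℤ.∣i∣≡0⇒i≡0 eq))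
... | suc d = contradiction (subst (m ℕ.∣_) eq (∣⇒∣ᵤ m∣r-s)) (ℕ.>⇒∤ (begin-strict
    suc d            ≡⟨ sym eq ⟩
    ∣ + r - + s ∣    ≡⟨ cong ∣_∣ (ℤ.m-n≡m⊖n r s) ⟩
    ∣ r ℤ.⊖ s ∣      ≤⟨ ℤ.∣m⊝n∣≤m⊔n r s ⟩
    r ℕ.⊔ s          <⟨ ℕ.⊔-lub r<m s<m ⟩
    m                ∎))
  where open ℕ.≤-Reasoning

%ℕ-unique : ∀ {x m r} .{{_ : ℕ.NonZero m}} → x ≡ + r mod + m → r ℕ.< m → x %ℕ m ≡ r
%ℕ-unique {x} {m} x≡r r<m =
  residue-unique (≡-mod-trans (≡-mod-sym (≡-mod-%ℕ x m)) x≡r) (n%ℕd<d x m) r<m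

≢-mod-by-residue : ∀ {x m r} .{{_ : ℕ.NonZero m}} → x %ℕ m ≢ r → r ℕ.< m → ¬ (x ≡ + r mod + m)
≢-mod-by-residue x%m≢r r<m x≡r = x%m≢r (%ℕ-unique x≡r r<m)

≡0-mod⇒∣ : ∀ {n m} → + n ≡ + 0 mod + m → m ℕ.∣ n
≡0-mod⇒∣ {n} (mod∣ m∣n-0) = subst (_ ℕ.∣_) (ℕ.+-identityʳ n) (∣⇒∣ᵤ m∣n-0)

even⇒≡2*half : ∀ {n} → + n ≡ + 0 mod + 2 → n ≡ 2 ℕ.* (n ℕ./ 2)
even⇒≡2*half {n} n-even =
  trans (m≡m%n+[m/n]*n n 2) (trans (cong (ℕ._+ n ℕ./ 2 ℕ.* 2) (%ℕ-unique n-even (s≤s z≤n))) (ℕ.*-comm (n ℕ./ 2) 2))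

-- Squares modulo 2, 3, 4 and 8

parity : ∀ x → x ≡ + 0 mod + 2 ⊎ x ≡ + 1 mod + 2
parity x with residue x 2
... | 0 , _ , p = inj₁ p
... | 1 , _ , p = inj₂ p
... | suc (suc _) , s≤s (s≤s ()) , _

odd≢even : ∀ {x} → x ≡ + 1 mod + 2 → ¬ (x ≡ + 0 mod + 2)
odd≢even x≡1 x≡0 = ≢-mod-by-residue (λ ()) (s≤s z≤n) (≡-mod-trans (≡-mod-sym x≡1) x≡0)

*≡1-mod-4⇒odd : ∀ {x y} → x * y ≡ + 1 mod + 4 → x ≡ + 1 mod + 2
*≡1-mod-4⇒odd {x} {y} xy≡1 with parity x
... | inj₂ x-odd  = x-odd
... | inj₁ x-even = contradiction (*-cong-mod x-even (≡⇒≡-mod {x = y} refl))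
                                  (odd≢even (≡-mod-weaken (divides (+ 2) refl) xy≡1))

≡-mod-4⇒odd : ∀ {x r} → x ≡ + r mod + 4 → + r ≡ + 1 mod + 2 → x ≡ + 1 mod + 2
≡-mod-4⇒odd x≡r r-odd = ≡-mod-trans (≡-mod-weaken (divides (+ 2) refl) x≡r) r-odd

≡1-mod-cancelˡ : ∀ {x y m} → x ≡ + 1 mod m → x * y ≡ + 1 mod m → y ≡ + 1 mod m
≡1-mod-cancelˡ {x} {y} {m} x≡1 xy≡1 = begin
  y          ≡⟨ sym (ℤ.*-identityˡ y) ⟩
  + 1 * y    ≈⟨ *-cong-mod (≡-mod-sym x≡1) (≡⇒≡-mod refl) ⟩
  x * y      ≈⟨ xy≡1 ⟩
  + 1        ∎
  where open ≡-mod-Reasoning m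

consecutive-product-even : ∀ x → x * (x + + 1) ≡ + 0 mod + 2
consecutive-product-even x with residue x 2
... | 0 , _ , p = *-cong-mod p (+-cong-mod p (≡⇒≡-mod refl))
... | 1 , _ , p = ≡-mod-trans (*-cong-mod p (+-cong-mod p (≡⇒≡-mod refl))) (multiple≡0-mod (+ 1) (+ 2))
... | suc (suc _) , s≤s (s≤s ()) , _

square+1-cong : ∀ {x y m} → x ≡ y mod m → x * x + + 1 ≡ y * y + + 1 mod m
square+1-cong x≡y = +-cong-mod (*-cong-mod x≡y x≡y) (≡⇒≡-mod refl)

square+1≡0-mod-2⇒odd : ∀ x → x * x + + 1 ≡ + 0 mod + 2 → x ≡ + 1 mod + 2
square+1≡0-mod-2⇒odd x x²+1≡0 with residue x 2
... | 0 , _ , p = contradiction (≡-mod-trans (≡-mod-sym (square+1-cong p)) x²+1≡0) (odd≢even (≡⇒≡-mod refl))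
... | 1 , _ , p = p
... | suc (suc _) , s≤s (s≤s ()) , _

square+1≢0-mod-3 : ∀ x → ¬ (x * x + + 1 ≡ + 0 mod + 3)
square+1≢0-mod-3 x x²+1≡0 with residue x 3
... | 0 , _ , p = ≢-mod-by-residue (λ ()) (s≤s z≤n) (≡-mod-trans (≡-mod-sym (square+1-cong p)) x²+1≡0)
... | 1 , _ , p = ≢-mod-by-residue (λ ()) (s≤s z≤n) (≡-mod-trans (≡-mod-sym (square+1-cong p)) x²+1≡0)
... | 2 , _ , p = ≢-mod-by-residue (λ ()) (s≤s z≤n) (≡-mod-trans (≡-mod-sym (square+1-cong p)) x²+1≡0)
... | suc (suc (suc _)) , s≤s (s≤s (s≤s ())) , _

square+1≢0-mod-4 : ∀ x → ¬ (x * x + + 1 ≡ + 0 mod + 4)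
square+1≢0-mod-4 x x²+1≡0 with residue x 4
... | 0 , _ , p = ≢-mod-by-residue (λ ()) (s≤s z≤n) (≡-mod-trans (≡-mod-sym (square+1-cong p)) x²+1≡0)
... | 1 , _ , p = ≢-mod-by-residue (λ ()) (s≤s z≤n) (≡-mod-trans (≡-mod-sym (square+1-cong p)) x²+1≡0)
... | 2 , _ , p = ≢-mod-by-residue (λ ()) (s≤s z≤n) (≡-mod-trans (≡-mod-sym (square+1-cong p)) x²+1≡0)
... | 3 , _ , p = ≢-mod-by-residue (λ ()) (s≤s z≤n) (≡-mod-trans (≡-mod-sym (square+1-cong p)) x²+1≡0)
... | suc (suc (suc (suc _))) , s≤s (s≤s (s≤s (s≤s ()))) , _

square+1-mod-8 : ∀ y → y * y + + 1 ≡ + 1 mod + 4 ⊎ y * y + + 1 ≡ + 2 mod + 8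
square+1-mod-8 y with residue y 8
... | 0 , _ , p = inj₁ (≡-mod-weaken (divides (+ 2) refl) (square+1-cong p))
... | 1 , _ , p = inj₂ (square+1-cong p)
... | 2 , _ , p = inj₁ (≡-mod-trans (≡-mod-weaken (divides (+ 2) refl) (square+1-cong p)) (≡-mod-multiple (+ 1) (+ 1)))
... | 3 , _ , p = inj₂ (≡-mod-trans (square+1-cong p) (≡-mod-multiple (+ 2) (+ 1)))
... | 4 , _ , p = inj₁ (≡-mod-trans (≡-mod-weaken (divides (+ 2) refl) (square+1-cong p)) (≡-mod-multiple (+ 1) (+ 4)))
... | 5 , _ , p = inj₂ (≡-mod-trans (square+1-cong p) (≡-mod-multiple (+ 2) (+ 3)))
... | 6 , _ , p = inj₁ (≡-mod-trans (≡-mod-weaken (divides (+ 2) refl) (square+1-cong p)) (≡-mod-multiple (+ 1) (+ 9)))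
... | 7 , _ , p = inj₂ (≡-mod-trans (square+1-cong p) (≡-mod-multiple (+ 2) (+ 6)))
... | suc (suc (suc (suc (suc (suc (suc (suc _))))))) , s≤s (s≤s (s≤s (s≤s (s≤s (s≤s (s≤s (s≤s ()))))))) , _

square≡1-mod-3 : ∀ x → ¬ (x ≡ + 0 mod + 3) → x * x ≡ + 1 mod + 3
square≡1-mod-3 x x≢0 with residue x 3
... | 0 , _ , p = contradiction p x≢0
... | 1 , _ , p = *-cong-mod p p
... | 2 , _ , p = ≡-mod-trans (*-cong-mod p p) (≡-mod-multiple (+ 1) (+ 1))
... | suc (suc (suc _)) , s≤s (s≤s (s≤s ())) , _

-- Odd divisors of y² + 1

pos-square+1 : ∀ z → + z * + z + + 1 ≡ + (z ℕ.* z ℕ.+ 1)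
pos-square+1 z = sym (trans (ℤ.pos-+ (z ℕ.* z) 1) (cong (_+ + 1) (ℤ.pos-* z z)))

reduced-square+1 : ∀ D .{{_ : ℕ.NonZero D}} y → y * y + + 1 ≡ + 0 mod + D →
                   ∃[ z ] z ℕ.< D × D ℕ.∣ z ℕ.* z ℕ.+ 1
reduced-square+1 D y y²+1≡0 = z , n%ℕd<d y D , subst (D ℕ.∣_) ∣z²+1∣ (∣⇒∣ᵤ D∣z²+1)
  where
  z = y %ℕ D
  open _≡_mod_ (≡-mod-trans (square+1-cong (≡-mod-sym (≡-mod-%ℕ y D))) y²+1≡0)
    renaming (∣-difference to D∣z²+1)
  ∣z²+1∣ : ∣ + z * + z + + 1 - + 0 ∣ ≡ z ℕ.* z ℕ.+ 1
  ∣z²+1∣ = cong ∣_∣ (trans (ℤ.+-identityʳ _) (pos-square+1 z))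

quotient<divisor : ∀ {z g D} → 0 ℕ.< z → z ℕ.< D → z ℕ.* z ℕ.+ 1 ≡ g ℕ.* D → g ℕ.< D
quotient<divisor {z} {g} {D@(suc _)} 0<z z<D z²+1≡gD = ℕ.*-cancelʳ-< D g D (begin-strict
  g ℕ.* D        ≡⟨ sym z²+1≡gD ⟩
  z ℕ.* z ℕ.+ 1  ≤⟨ ℕ.+-monoʳ-≤ (z ℕ.* z) 0<z ⟩
  z ℕ.* z ℕ.+ z  ≡⟨ trans (ℕ.+-comm (z ℕ.* z) z) (sym (ℕ.*-suc z z)) ⟩
  z ℕ.* suc z    ≤⟨ ℕ.*-monoʳ-≤ z z<D ⟩
  z ℕ.* D        <⟨ ℕ.*-monoˡ-< D z<D ⟩
  D ℕ.* D        ∎)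
  where open ℕ.≤-Reasoning

-- If z is even then gD ≡ 1 (mod 4); if z is odd then g = 2w with wD ≡ 1 (mod 4).
odd-part-of-cofactor : ∀ z g D → z ℕ.* z ℕ.+ 1 ≡ g ℕ.* D → + D ≡ + 1 mod + 2 →
  ∃[ w ] w ℕ.≤ g × + z * + z + + 1 ≡ + 0 mod + w × + w * + D ≡ + 1 mod + 4
odd-part-of-cofactor z g D z²+1≡gD D-odd = by-residue (square+1-mod-8 (+ z))
  where
  z²+1≡g*D : + z * + z + + 1 ≡ + g * + D
  z²+1≡g*D = trans (pos-square+1 z) (trans (cong +_ z²+1≡gD) (ℤ.pos-* g D))

  even-cofactor : + g ≡ + 0 mod + 2 → + z * + z + + 1 ≡ + 2 mod + 8 →
    ∃[ w ] w ℕ.≤ g × + z * + z + + 1 ≡ + 0 mod + w × + w * + D ≡ + 1 mod + 4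
  even-cofactor g-even z²+1≡2 =
    w , m/n≤m g 2 , ≡-mod-trans (≡⇒≡-mod z²+1≡w*2D) (multiple≡0-mod (+ 2 * + D) (+ w)) ,
    *-cancelˡ-mod (+ 2) (≡-mod-trans (≡⇒≡-mod 2wD≡z²+1) z²+1≡2)
    where
    w = g ℕ./ 2
    g≡2w : g ≡ 2 ℕ.* w
    g≡2w = even⇒≡2*half g-even
    2wD≡z²+1 : + 2 * (+ w * + D) ≡ + z * + z + + 1
    2wD≡z²+1 = begin
      + 2 * (+ w * + D)   ≡⟨ sym (ℤ.*-assoc (+ 2) (+ w) (+ D)) ⟩
      + 2 * + w * + D     ≡⟨ cong (_* + D) (sym (trans (cong +_ g≡2w) (ℤ.pos-* 2 w))) ⟩
      + g * + D           ≡⟨ sym z²+1≡g*D ⟩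
      + z * + z + + 1     ∎
      where open ≡-Reasoning
    z²+1≡w*2D : + z * + z + + 1 ≡ + w * (+ 2 * + D)
    z²+1≡w*2D = trans (sym 2wD≡z²+1) (rearrange (+ w) (+ D))
      where
      rearrange : ∀ w D → + 2 * (w * D) ≡ w * (+ 2 * D)
      rearrange = solve-∀

  by-residue : + z * + z + + 1 ≡ + 1 mod + 4 ⊎ + z * + z + + 1 ≡ + 2 mod + 8 →
    ∃[ w ] w ℕ.≤ g × + z * + z + + 1 ≡ + 0 mod + w × + w * + D ≡ + 1 mod + 4
  by-residue (inj₁ z²+1≡1) = g , ℕ.≤-refl , ≡-mod-trans (≡⇒≡-mod z²+1≡g*D) (multiple≡0-mod (+ D) (+ g)) ,
                             ≡-mod-trans (≡⇒≡-mod (sym z²+1≡g*D)) z²+1≡1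
  by-residue (inj₂ z²+1≡2) with parity (+ g)
  ... | inj₁ g-even = even-cofactor g-even z²+1≡2
  ... | inj₂ g-odd  = contradiction gD-even (odd≢even (*-cong-mod g-odd D-odd))
    where
    gD-even : + g * + D ≡ + 0 mod + 2
    gD-even = ≡-mod-trans (≡⇒≡-mod (sym z²+1≡g*D))
                (≡-mod-trans (≡-mod-weaken (divides (+ 4) refl) z²+1≡2) (multiple≡0-mod (+ 1) (+ 2)))

-- Reducing y modulo D makes the odd part of the cofactor of D in y² + 1 a smaller such divisor.
odd∣square+1⇒≡1-mod-4 : ∀ D y → y * y + + 1 ≡ + 0 mod + D → + D ≡ + 1 mod + 2 → + D ≡ + 1 mod + 4
odd∣square+1⇒≡1-mod-4 = <-rec Goal descend
  where
  Goal : ℕ → Set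
  Goal D = ∀ y → y * y + + 1 ≡ + 0 mod + D → + D ≡ + 1 mod + 2 → + D ≡ + 1 mod + 4

  descend : ∀ D → (∀ {w} → w ℕ.< D → Goal w) → Goal D
  descend zero _ _ _ 0≡1 = contradiction (≡-mod-sym 0≡1) (odd≢even (≡⇒≡-mod refl))
  descend D@(suc _) smaller y y²+1≡0 D-odd = from-reduced (reduced-square+1 D y y²+1≡0)
    where
    from-reduced : ∃[ z ] z ℕ.< D × D ℕ.∣ z ℕ.* z ℕ.+ 1 → + D ≡ + 1 mod + 4
    from-reduced (zero , _ , ℕ.divides g 1≡gD) =
      subst (λ d → + d ≡ + 1 mod + 4) (sym (ℕ.m*n≡1⇒n≡1 g D (sym 1≡gD))) (≡⇒≡-mod refl)
    from-reduced (z@(suc _) , z<D , ℕ.divides g z²+1≡gD) = from-cofactor (odd-part-of-cofactor z g D z²+1≡gD D-odd)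
      where
      from-cofactor : ∃[ w ] w ℕ.≤ g × + z * + z + + 1 ≡ + 0 mod + w × + w * + D ≡ + 1 mod + 4 →
                      + D ≡ + 1 mod + 4
      from-cofactor (w , w≤g , z²+1≡0 , wD≡1) = ≡1-mod-cancelˡ w≡1 wD≡1
        where
        w≡1 : + w ≡ + 1 mod + 4
        w≡1 = smaller (ℕ.≤-<-trans w≤g (quotient<divisor (s≤s z≤n) z<D z²+1≡gD)) (+ z) z²+1≡0 (*≡1-mod-4⇒odd wD≡1)

-- Finite sums

∑ : ℕ → (ℕ → ℤ) → ℤ
∑ zero    f = + 0
∑ (suc n) f = ∑ n f + f (suc n)

∑-cong : ∀ n {f g : ℕ → ℤ} → (∀ {j} → 1 ℕ.≤ j → j ℕ.≤ n → f j ≡ g j) → ∑ n f ≡ ∑ n g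
∑-cong zero    f≗g = refl
∑-cong (suc n) f≗g =
  cong₂ _+_ (∑-cong n (λ 1≤j j≤n → f≗g 1≤j (ℕ.m≤n⇒m≤1+n j≤n))) (f≗g (s≤s z≤n) ℕ.≤-refl)

∑-distrib-+ : ∀ n (f g : ℕ → ℤ) → ∑ n (λ j → f j + g j) ≡ ∑ n f + ∑ n g
∑-distrib-+ zero    f g = refl
∑-distrib-+ (suc n) f g = trans (cong (_+ (f (suc n) + g (suc n))) (∑-distrib-+ n f g))
                               (interchange (∑ n f) (∑ n g) (f (suc n)) (g (suc n)))
  where
  interchange : ∀ a b c d → a + b + (c + d) ≡ a + c + (b + d)
  interchange = solve-∀

∑-*ˡ : ∀ n c (f : ℕ → ℤ) → ∑ n (λ j → c * f j) ≡ c * ∑ n f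
∑-*ˡ zero    c f = sym (ℤ.*-zeroʳ c)
∑-*ˡ (suc n) c f = trans (cong (_+ c * f (suc n)) (∑-*ˡ n c f)) (sym (ℤ.*-distribˡ-+ c (∑ n f) (f (suc n))))

∑-*ʳ : ∀ n (f : ℕ → ℤ) c → ∑ n (λ j → f j * c) ≡ ∑ n f * c
∑-*ʳ n f c = trans (∑-cong n (λ {j} _ _ → ℤ.*-comm (f j) c)) (trans (∑-*ˡ n c f) (ℤ.*-comm c (∑ n f)))

∑-linear : ∀ n c d (f g : ℕ → ℤ) → ∑ n (λ j → c * f j + d * g j) ≡ c * ∑ n f + d * ∑ n g
∑-linear n c d f g = trans (∑-distrib-+ n (λ j → c * f j) (λ j → d * g j)) (cong₂ _+_ (∑-*ˡ n c f) (∑-*ˡ n d g))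

∑-const : ∀ n c → ∑ n (λ _ → c) ≡ + n * c
∑-const zero    c = sym (ℤ.*-zeroˡ c)
∑-const (suc n) c = trans (cong (_+ c) (∑-const n c)) (step (+ n) c)
  where
  step : ∀ n c → n * c + c ≡ (+ 1 + n) * c
  step = solve-∀

∑-zero : ∀ n {f : ℕ → ℤ} → (∀ {j} → 1 ℕ.≤ j → j ℕ.≤ n → f j ≡ + 0) → ∑ n f ≡ + 0
∑-zero n f≗0 = trans (∑-cong n f≗0) (trans (∑-const n (+ 0)) (ℤ.*-zeroʳ (+ n)))

∑-comm : ∀ m n (h : ℕ → ℕ → ℤ) → ∑ m (λ j → ∑ n (h j)) ≡ ∑ n (λ i → ∑ m (λ j → h j i))
∑-comm zero    n h = sym (∑-zero n (λ _ _ → refl))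
∑-comm (suc m) n h = trans (cong (_+ ∑ n (h (suc m))) (∑-comm m n h))
                          (sym (∑-distrib-+ n (λ i → ∑ m (λ j → h j i)) (h (suc m))))

∑-mono-≤ : ∀ n {f g : ℕ → ℤ} → (∀ {j} → 1 ℕ.≤ j → j ℕ.≤ n → f j ℤ.≤ g j) → ∑ n f ℤ.≤ ∑ n g
∑-mono-≤ zero    f≤g = ℤ.≤-refl
∑-mono-≤ (suc n) f≤g =
  ℤ.+-mono-≤ (∑-mono-≤ n (λ 1≤j j≤n → f≤g 1≤j (ℕ.m≤n⇒m≤1+n j≤n))) (f≤g (s≤s z≤n) ℕ.≤-refl)

sum-of-integers : ∀ n → + 2 * ∑ n (λ j → + j) ≡ + n * (+ n + + 1)
sum-of-integers zero    = refl
sum-of-integers (suc n) = trans (ℤ.*-distribˡ-+ (+ 2) (∑ n (λ j → + j)) (+ suc n))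
                     (trans (cong (_+ + 2 * + suc n) (sum-of-integers n)) (step (+ n)))
  where
  step : ∀ n → n * (n + + 1) + + 2 * (+ 1 + n) ≡ (+ 1 + n) * ((+ 1 + n) + + 1)
  step = solve-∀

sum-of-squares : ∀ n → + 6 * ∑ n (λ j → + j * + j) ≡ + n * (+ n + + 1) * (+ 2 * + n + + 1)
sum-of-squares zero    = refl
sum-of-squares (suc n) = trans (ℤ.*-distribˡ-+ (+ 6) (∑ n (λ j → + j * + j)) (+ suc n * + suc n))
                         (trans (cong (_+ + 6 * (+ suc n * + suc n)) (sum-of-squares n)) (step (+ n)))
  where
  step : ∀ n → n * (n + + 1) * (+ 2 * n + + 1) + + 6 * ((+ 1 + n) * (+ 1 + n)) ≡
               (+ 1 + n) * ((+ 1 + n) + + 1) * (+ 2 * (+ 1 + n) + + 1)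
  step = solve-∀

+-tight : ∀ {x y a b} → x ℤ.≤ a → y ℤ.≤ b → x + y ≡ a + b → x ≡ a × y ≡ b
+-tight {x} {y} {a} {b} x≤a y≤b x+y≡a+b = x≡a , y≡b
  where
  y≡b : y ≡ b
  y≡b = ℤ.≤-antisym y≤b (begin
    b              ≡⟨ add-sub a b ⟩
    a + b - a      ≤⟨ ℤ.+-monoʳ-≤ (a + b) (ℤ.neg-mono-≤ x≤a) ⟩
    a + b - x      ≡⟨ cong (_- x) (sym x+y≡a+b) ⟩
    x + y - x      ≡⟨ sub-add x y ⟩
    y              ∎)
    where
    open ℤ.≤-Reasoning
    add-sub : ∀ a b → b ≡ a + b - a
    add-sub = solve-∀
    sub-add : ∀ x y → x + y - x ≡ y
    sub-add = solve-∀
  x≡a : x ≡ a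
  x≡a = begin
    x              ≡⟨ add-sub x y ⟩
    x + y - y      ≡⟨ cong₂ _-_ x+y≡a+b y≡b ⟩
    a + b - b      ≡⟨ sym (add-sub a b) ⟩
    a              ∎
    where
    open ≡-Reasoning
    add-sub : ∀ x y → x ≡ x + y - y
    add-sub = solve-∀

∑≡n⇒all≡1 : ∀ n {c : ℕ → ℤ} → (∀ {i} → 1 ℕ.≤ i → i ℕ.≤ n → c i ℤ.≤ + 1) → ∑ n c ≡ + n →
            ∀ {i} → 1 ℕ.≤ i → i ℕ.≤ n → c i ≡ + 1
∑≡n⇒all≡1 zero    _ _ 1≤i i≤0 = contradiction (ℕ.≤-trans 1≤i i≤0) λ ()
∑≡n⇒all≡1 (suc n) {c} c≤1 ∑c≡n+1 1≤i i≤n+1 = pointwise 1≤i (ℕ.m≤n⇒m<n∨m≡n i≤n+1)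
  where
  ∑n≤n : ∑ n c ℤ.≤ + n
  ∑n≤n = ℤ.≤-trans (∑-mono-≤ n (λ 1≤j j≤n → c≤1 1≤j (ℕ.m≤n⇒m≤1+n j≤n)))
                   (ℤ.≤-reflexive (trans (∑-const n (+ 1)) (ℤ.*-identityʳ (+ n))))
  split : ∑ n c ≡ + n × c (suc n) ≡ + 1
  split = +-tight ∑n≤n (c≤1 (s≤s z≤n) ℕ.≤-refl) (trans ∑c≡n+1 (ℤ.+-comm (+ 1) (+ n)))
  pointwise : ∀ {i} → 1 ℕ.≤ i → i ℕ.< suc n ⊎ i ≡ suc n → c i ≡ + 1
  pointwise _   (inj₂ refl)      = proj₂ split
  pointwise 1≤i (inj₁ (s≤s i≤n)) =
    ∑≡n⇒all≡1 n (λ 1≤j j≤n → c≤1 1≤j (ℕ.m≤n⇒m≤1+n j≤n)) (proj₁ split) 1≤i i≤n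

δ : ℕ → ℕ → ℤ
δ i j = if does (i ℕ.≟ j) then + 1 else + 0

δ-refl : ∀ i → δ i i ≡ + 1
δ-refl i rewrite dec-true (i ℕ.≟ i) refl = refl

δ-≢ : ∀ {i j} → i ≢ j → δ i j ≡ + 0
δ-≢ {i} {j} i≢j rewrite dec-false (i ℕ.≟ j) i≢j = refl

∑-δ : ∀ n {x} (g : ℕ → ℤ) → 1 ℕ.≤ x → x ℕ.≤ n → ∑ n (λ i → δ x i * g i) ≡ g x
∑-δ zero    g 1≤x x≤0 = contradiction (ℕ.≤-trans 1≤x x≤0) λ ()
∑-δ (suc n) {x} g 1≤x x≤n+1 with ℕ.m≤n⇒m<n∨m≡n x≤n+1
... | inj₂ refl = begin
  ∑ n (λ i → δ x i * g i) + δ x x * g x  ≡⟨ cong₂ _+_ (∑-zero n earlier) (cong (_* g x) (δ-refl x)) ⟩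
  + 0 + + 1 * g x                         ≡⟨ trans (ℤ.+-identityˡ _) (ℤ.*-identityˡ (g x)) ⟩
  g x                                     ∎
  where
  open ≡-Reasoning
  earlier : ∀ {i} → 1 ℕ.≤ i → i ℕ.≤ n → δ x i * g i ≡ + 0
  earlier {i} _ i≤n = trans (cong (_* g i) (δ-≢ (λ x≡i → ℕ.<⇒≢ (s≤s i≤n) (sym x≡i)))) (ℤ.*-zeroˡ (g i))
... | inj₁ (s≤s x≤n) = trans (cong₂ _+_ (∑-δ n g 1≤x x≤n) (cong (_* g (suc n)) (δ-≢ (ℕ.<⇒≢ (s≤s x≤n)))))
                             (trans (cong (_+_ (g x)) (ℤ.*-zeroˡ (g (suc n)))) (ℤ.+-identityʳ (g x)))

-- Every i in [1, n] has at most one preimage under σ, and the numbers of preimages add up to n.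
module _ {n : ℕ} {σ : ℕ → ℕ}
  (σ-into : ∀ {j} → 1 ℕ.≤ j → j ℕ.≤ n → 1 ℕ.≤ σ j × σ j ℕ.≤ n)
  (σ-injective : ∀ {i j} → 1 ℕ.≤ i → i ℕ.≤ n → 1 ℕ.≤ j → j ℕ.≤ n → σ i ≡ σ j → i ≡ j)
  where

  private
    preimages : ℕ → ℕ → ℤ
    preimages m i = ∑ m (λ j → δ (σ j) i)

    preimages≤1 : ∀ m i → m ℕ.≤ n → preimages m i ℤ.≤ + 1
    preimages≤1 zero    i _     = ℤ.+≤+ z≤n
    preimages≤1 (suc m) i m+1≤n with σ (suc m) ℕ.≟ i
    ... | yes σ[m+1]≡i = ℤ.≤-reflexive (begin
      preimages m i + δ (σ (suc m)) i   ≡⟨ cong₂ _+_ (∑-zero m earlier≢i) (cong (λ t → δ t i) σ[m+1]≡i) ⟩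
      + 0 + δ i i                       ≡⟨ trans (ℤ.+-identityˡ _) (δ-refl i) ⟩
      + 1                               ∎)
      where
      open ≡-Reasoning
      earlier≢i : ∀ {j} → 1 ℕ.≤ j → j ℕ.≤ m → δ (σ j) i ≡ + 0
      earlier≢i {j} 1≤j j≤m = δ-≢ λ σj≡i → ℕ.<⇒≢ (s≤s j≤m)
        (σ-injective 1≤j (ℕ.≤-trans (ℕ.m≤n⇒m≤1+n j≤m) m+1≤n) (s≤s z≤n) m+1≤n (trans σj≡i (sym σ[m+1]≡i)))
    ... | no  σ[m+1]≢i = ℤ.≤-trans (ℤ.≤-reflexive (trans (cong (_+_ (preimages m i)) (δ-≢ σ[m+1]≢i)) (ℤ.+-identityʳ _)))
                                   (preimages≤1 m i (ℕ.≤-trans (ℕ.n≤1+n m) m+1≤n))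

    ∑-preimages : ∑ n (preimages n) ≡ + n
    ∑-preimages = begin
      ∑ n (λ i → ∑ n (λ j → δ (σ j) i))   ≡⟨ ∑-comm n n (λ j i → δ (σ j) i) ⟨
      ∑ n (λ j → ∑ n (λ i → δ (σ j) i))   ≡⟨ ∑-cong n one-image ⟩
      ∑ n (λ _ → + 1)                     ≡⟨ trans (∑-const n (+ 1)) (ℤ.*-identityʳ (+ n)) ⟩
      + n                                 ∎
      where
      open ≡-Reasoning
      one-image : ∀ {j} → 1 ℕ.≤ j → j ℕ.≤ n → ∑ n (λ i → δ (σ j) i) ≡ + 1
      one-image {j} 1≤j j≤n = let 1≤σj , σj≤n = σ-into 1≤j j≤n in
        trans (∑-cong n (λ {i} _ _ → sym (ℤ.*-identityʳ (δ (σ j) i)))) (∑-δ n (λ _ → + 1) 1≤σj σj≤n)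

    preimages≡1 : ∀ {i} → 1 ℕ.≤ i → i ℕ.≤ n → preimages n i ≡ + 1
    preimages≡1 = ∑≡n⇒all≡1 n (λ {i} _ _ → preimages≤1 n i ℕ.≤-refl) ∑-preimages

  ∑-permute : ∀ (f : ℕ → ℤ) → ∑ n (λ j → f (σ j)) ≡ ∑ n f
  ∑-permute f = begin
    ∑ n (λ j → f (σ j))                        ≡⟨ ∑-cong n select ⟨
    ∑ n (λ j → ∑ n (λ i → δ (σ j) i * f i))    ≡⟨ ∑-comm n n (λ j i → δ (σ j) i * f i) ⟩
    ∑ n (λ i → ∑ n (λ j → δ (σ j) i * f i))    ≡⟨ ∑-cong n (λ {i} _ _ → ∑-*ʳ n (λ j → δ (σ j) i) (f i)) ⟩
    ∑ n (λ i → preimages n i * f i)            ≡⟨ ∑-cong n (λ {i} 1≤i i≤n → cong (_* f i) (preimages≡1 1≤i i≤n)) ⟩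
    ∑ n (λ i → + 1 * f i)                      ≡⟨ ∑-cong n (λ {i} _ _ → ℤ.*-identityˡ (f i)) ⟩
    ∑ n f                                      ∎
    where
    open ≡-Reasoning
    select : ∀ {j} → 1 ℕ.≤ j → j ℕ.≤ n → ∑ n (λ i → δ (σ j) i * f i) ≡ f (σ j)
    select 1≤j j≤n = let 1≤σj , σj≤n = σ-into 1≤j j≤n in ∑-δ n f 1≤σj σj≤n

-- The sawtooth function at multiples of 1/b

-- 2b · ((r/b)) for 0 ≤ r < b.
sawNumerator : ℕ → ℕ → ℤ
sawNumerator b zero    = + 0
sawNumerator b (suc r) = + 2 * + suc r - + b

sawNumerator-nonzero : ∀ b {r} → 1 ℕ.≤ r → sawNumerator b r ≡ + 2 * + r - + b
sawNumerator-nonzero b {suc r} _ = refl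

saw-integral : ∀ x → ℚ.floor x ℚ./ 1 ≡ x → saw x ≡ ℚ.0ℚ
saw-integral x F/1≡x with (ℚ.floor x ℚ./ 1) ℚ.≟ x
... | yes _     = refl
... | no F/1≢x = contradiction F/1≡x F/1≢x

saw-fractional : ∀ x → ℚ.floor x ℚ./ 1 ≢ x → saw x ≡ x ℚ.- ℚ.floor x ℚ./ 1 ℚ.- ℚ.½
saw-fractional x F/1≢x with (ℚ.floor x ℚ./ 1) ℚ.≟ x
... | yes F/1≡x = contradiction F/1≡x F/1≢x
... | no _      = refl

+-same-denominator : ∀ x y c → mkℚᵘ x c ℚᵘ.+ mkℚᵘ y c ≃ mkℚᵘ (x + y) c
+-same-denominator x y c = *≡* (trans (distrib x y (+ suc c)) (cong ((x + y) *_) (sym (ℤ.pos-* (suc c) (suc c)))))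
  where
  distrib : ∀ x y C → (x * C + y * C) * C ≡ (x + y) * (C * C)
  distrib = solve-∀

sumFrom1≃∑ : ∀ N (f : ℕ → ℚ) (g : ℕ → ℤ) c → (∀ j → toℚᵘ (f j) ≃ mkℚᵘ (g j) c) →
             toℚᵘ (sumFrom1 N f) ≃ mkℚᵘ (∑ N g) c
sumFrom1≃∑ zero    f g c f≃g = *≡* refl
sumFrom1≃∑ (suc N) f g c f≃g = ℚᵘ.≃-trans (ℚ.toℚᵘ-homo-+ (sumFrom1 N f) (f (suc N)))
  (ℚᵘ.≃-trans (ℚᵘ.+-cong (sumFrom1≃∑ N f g c f≃g) (f≃g (suc N))) (+-same-denominator (∑ N g) (g (suc N)) c))

module _ (n : ℕ) where

  private
    b : ℕ
    b = suc n

    toℚᵘ-homo-- : ∀ p q → toℚᵘ (p ℚ.- q) ≃ toℚᵘ p ℚᵘ.- toℚᵘ q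
    toℚᵘ-homo-- p q = ℚᵘ.≃-trans (ℚ.toℚᵘ-homo-+ p (ℚ.- q)) (ℚᵘ.+-congʳ (toℚᵘ p) (ℚ.toℚᵘ-homo‿- q))

  saw≃sawNumerator : ∀ m x → toℚᵘ x ≃ mkℚᵘ m n →
                     toℚᵘ (saw x) ≃ mkℚᵘ (sawNumerator b (m %ℕ b)) (ℕ.pred (2 ℕ.* b))
  saw≃sawNumerator m x@(mkℚ N Dm _) N*b≡m*D = by-residue g refl
    where
    D = suc Dm
    F = ℚ.floor x
    ρ = N %ℕ D
    g = m %ℕ b

    N≡ρ+FD : N ≡ + ρ + F * + D
    N≡ρ+FD = trans (a≡a%ℕn+[a/ℕn]*n N D) (cong (λ t → + ρ + t * + D) (sym (div-pos-is-/ℕ N D)))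

    ρb≡gD : ρ ℕ.* b ≡ g ℕ.* D
    ρb≡gD = residue-unique {D ℕ.* b} (begin
      + (ρ ℕ.* b)                          ≡⟨ ℤ.pos-* ρ b ⟩
      + ρ * + b                            ≈⟨ ≡-mod-sym (≡-mod-multiple (+ ρ * + b) F) ⟩
      + ρ * + b + F * + (D ℕ.* b)          ≡⟨ cong (λ t → + ρ * + b + F * t) (ℤ.pos-* D b) ⟩
      + ρ * + b + F * (+ D * + b)          ≡⟨ trans (factor (+ ρ) F (+ D) (+ b)) (cong (_* + b) (sym N≡ρ+FD)) ⟩
      N * + b                              ≡⟨ ℚᵘ.drop-*≡* N*b≡m*D ⟩
      m * + D                              ≡⟨ cong (_* + D) (a≡a%ℕn+[a/ℕn]*n m b) ⟩
      (+ g + (m /ℕ b) * + b) * + D         ≡⟨ distrib (+ g) (m /ℕ b) (+ D) (+ b) ⟩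
      + g * + D + (m /ℕ b) * (+ D * + b)   ≡⟨ cong (λ t → + g * + D + (m /ℕ b) * t) (ℤ.pos-* D b) ⟨
      + g * + D + (m /ℕ b) * + (D ℕ.* b)   ≈⟨ ≡-mod-multiple (+ g * + D) (m /ℕ b) ⟩
      + g * + D                            ≡⟨ ℤ.pos-* g D ⟨
      + (g ℕ.* D)                          ∎)
      (ℕ.*-monoˡ-< b (n%ℕd<d N D)) (subst (g ℕ.* D ℕ.<_) (ℕ.*-comm b D) (ℕ.*-monoˡ-< D (n%ℕd<d m b)))
      where
      open ≡-mod-Reasoning (+ (D ℕ.* b))
      factor : ∀ r f d b → r * b + f * (d * b) ≡ (r + f * d) * b
      factor = solve-∀
      distrib : ∀ g q d b → (g + q * b) * d ≡ g * d + q * (d * b)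
      distrib = solve-∀

    F/1≡x⇒ρ≡0 : F ℚ./ 1 ≡ x → ρ ≡ 0
    F/1≡x⇒ρ≡0 F/1≡x = ℤ.+-injective (cancel (+ ρ) (F * + D) (begin
      F * + D                ≡⟨ ℚᵘ.drop-*≡* (ℚᵘ.≃-trans (ℚᵘ.≃-sym (ℚ.toℚᵘ-fromℚᵘ (mkℚᵘ F 0)))
                                                        (ℚᵘ.≃-reflexive (cong toℚᵘ F/1≡x))) ⟩
      N * + 1                ≡⟨ trans (ℤ.*-identityʳ N) N≡ρ+FD ⟩
      + ρ + F * + D          ∎))
      where
      open ≡-Reasoning
      cancel : ∀ r y → y ≡ r + y → r ≡ + 0
      cancel r y y≡r+y = trans (add-sub r y) (trans (cong (_- y) (sym y≡r+y)) (ℤ.+-inverseʳ y))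
        where
        add-sub : ∀ r y → r ≡ r + y - y
        add-sub = solve-∀
    ρ≡0⇒F/1≡x : ρ ≡ 0 → F ℚ./ 1 ≡ x
    ρ≡0⇒F/1≡x ρ≡0 = ℚ.toℚᵘ-injective (ℚᵘ.≃-trans (ℚ.toℚᵘ-fromℚᵘ (mkℚᵘ F 0)) (*≡* (sym (begin
      N * + 1                ≡⟨ trans (ℤ.*-identityʳ N) N≡ρ+FD ⟩
      + ρ + F * + D          ≡⟨ cong (λ r → + r + F * + D) ρ≡0 ⟩
      + 0 + F * + D          ≡⟨ ℤ.+-identityˡ (F * + D) ⟩
      F * + D                ∎))))
      where open ≡-Reasoning

    cross-multiplied : ∀ {g'} → g ≡ suc g' →
                     ((N * + 1 + - F * + D) * + 2 + - (+ 1) * + (D ℕ.* 1)) * + (2 ℕ.* b) ≡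
                     (+ 2 * + suc g' - + b) * + (D ℕ.* 1 ℕ.* 2)
    cross-multiplied {g'} g≡1+g' = begin
      ((N * + 1 + - F * + D) * + 2 + - (+ 1) * + (D ℕ.* 1)) * + (2 ℕ.* b)
        ≡⟨ cong₂ (λ u v → ((N * + 1 + - F * + D) * + 2 + - (+ 1) * u) * v) (ℤ.pos-* D 1) (ℤ.pos-* 2 b) ⟩
      ((N * + 1 + - F * + D) * + 2 + - (+ 1) * (+ D * + 1)) * (+ 2 * + b)
        ≡⟨ cong (λ t → ((t * + 1 + - F * + D) * + 2 + - (+ 1) * (+ D * + 1)) * (+ 2 * + b)) N≡ρ+FD ⟩
      (((+ ρ + F * + D) * + 1 + - F * + D) * + 2 + - (+ 1) * (+ D * + 1)) * (+ 2 * + b)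
        ≡⟨ expand (+ ρ) F (+ D) (+ b) ⟩
      + 4 * (+ ρ * + b) - + 2 * + D * + b
        ≡⟨ cong (λ t → + 4 * t - + 2 * + D * + b)
                (trans (sym (ℤ.pos-* ρ b)) (trans (cong +_ (trans ρb≡gD (cong (ℕ._* D) g≡1+g'))) (ℤ.pos-* (suc g') D))) ⟩
      + 4 * (+ suc g' * + D) - + 2 * + D * + b
        ≡⟨ collect (+ suc g') (+ D) (+ b) ⟩
      (+ 2 * + suc g' - + b) * (+ D * + 1 * + 2)
        ≡⟨ cong ((+ 2 * + suc g' - + b) *_) (trans (cong (_* + 2) (ℤ.pos-* D 1)) (ℤ.pos-* (D ℕ.* 1) 2)) ⟨
      (+ 2 * + suc g' - + b) * + (D ℕ.* 1 ℕ.* 2) ∎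
      where
      open ≡-Reasoning
      expand : ∀ ρ F D b → (((ρ + F * D) * + 1 + - F * D) * + 2 + - (+ 1) * (D * + 1)) * (+ 2 * b) ≡
                           + 4 * (ρ * b) - + 2 * D * b
      expand = solve-∀
      collect : ∀ g D b → + 4 * (g * D) - + 2 * D * b ≡ (+ 2 * g - b) * (D * + 1 * + 2)
      collect = solve-∀

    by-residue : ∀ g' → g ≡ g' → toℚᵘ (saw x) ≃ mkℚᵘ (sawNumerator b g') (ℕ.pred (2 ℕ.* b))
    by-residue zero g≡0 =
      ℚᵘ.≃-trans (ℚᵘ.≃-reflexive (cong toℚᵘ (saw-integral x (ρ≡0⇒F/1≡x ρ≡0)))) (*≡* refl)
      where
      ρ≡0 : ρ ≡ 0
      ρ≡0 = ℕ.m*n≡0⇒m≡0 ρ b (trans ρb≡gD (cong (ℕ._* D) g≡0))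
    by-residue (suc g') g≡1+g' = begin
      toℚᵘ (saw x)                                          ≡⟨ cong toℚᵘ (saw-fractional x F/1≢x) ⟩
      toℚᵘ (x ℚ.- F ℚ./ 1 ℚ.- ℚ.½)                           ≈⟨ toℚᵘ-homo-- (x ℚ.- F ℚ./ 1) ℚ.½ ⟩
      toℚᵘ (x ℚ.- F ℚ./ 1) ℚᵘ.- mkℚᵘ (+ 1) 1                  ≈⟨ ℚᵘ.+-congˡ (ℚᵘ.- mkℚᵘ (+ 1) 1)
                                                                 (ℚᵘ.≃-trans (toℚᵘ-homo-- x (F ℚ./ 1)) x-F/1) ⟩
      mkℚᵘ N Dm ℚᵘ.- mkℚᵘ F 0 ℚᵘ.- mkℚᵘ (+ 1) 1               ≈⟨ *≡* (cross-multiplied g≡1+g') ⟩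
      mkℚᵘ (sawNumerator b (suc g')) (ℕ.pred (2 ℕ.* b))      ∎
      where
      open ℚᵘ.≃-Reasoning
      x-F/1 : toℚᵘ x ℚᵘ.- toℚᵘ (F ℚ./ 1) ≃ mkℚᵘ N Dm ℚᵘ.- mkℚᵘ F 0
      x-F/1 = ℚᵘ.+-congʳ (toℚᵘ x) (ℚᵘ.-‿cong (ℚ.toℚᵘ-fromℚᵘ (mkℚᵘ F 0)))
      F/1≢x : F ℚ./ 1 ≢ x
      F/1≢x F/1≡x = ℕ.0≢1+n (sym (trans (sym g≡1+g')
        (ℕ.m*n≡0⇒m≡0 g D (trans (sym ρb≡gD) (cong (ℕ._* b) (F/1≡x⇒ρ≡0 F/1≡x))))))

  private
    2b-1 = ℕ.pred (2 ℕ.* b)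
    4b²-1 = ℕ.pred (suc 2b-1 ℕ.* suc 2b-1)

    saw-/ : ∀ m → toℚᵘ (saw (m ℚ./ b)) ≃ mkℚᵘ (sawNumerator b (m %ℕ b)) 2b-1
    saw-/ m = saw≃sawNumerator m (m ℚ./ b) (ℚ.toℚᵘ-fromℚᵘ (mkℚᵘ m n))

  sawProducts : ℤ → ℤ
  sawProducts a = ∑ b (λ j → sawNumerator b (j ℕ.% b) * sawNumerator b ((a * + j) %ℕ b))

  normDedekind≃sawProducts : ∀ a → toℚᵘ (normDedekind a b) ≃ mkℚᵘ (+ 12 * sawProducts a) (ℕ.pred (1 ℕ.* suc 4b²-1))
  normDedekind≃sawProducts a = ℚᵘ.≃-trans (ℚ.toℚᵘ-homo-* (+ 12 ℚ./ 1) (dedekind a b))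
    (ℚᵘ.*-cong {mkℚᵘ (+ 12) 0} ℚᵘ.≃-refl (sumFrom1≃∑ b _ _ 4b²-1 saw-product))
    where
    saw-product : ∀ j → toℚᵘ (saw (+ j ℚ./ b) ℚ.* saw ((a * + j) ℚ./ b)) ≃
                        mkℚᵘ (sawNumerator b (j ℕ.% b) * sawNumerator b ((a * + j) %ℕ b)) 4b²-1
    saw-product j = ℚᵘ.≃-trans (ℚ.toℚᵘ-homo-* (saw (+ j ℚ./ b)) (saw ((a * + j) ℚ./ b)))
                               (ℚᵘ.*-cong (saw-/ (+ j)) (saw-/ (a * + j)))

  3*sawProducts*q≡k*b² : ∀ a k q → normDedekind a b ≡ k ℚ./ suc q → + 3 * sawProducts a * + suc q ≡ k * (+ b * + b)
  3*sawProducts*q≡k*b² a k q S≡k/q = ℤ.*-cancelˡ-≡ (+ 4) _ _ (begin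
    + 4 * (+ 3 * sawProducts a * + suc q)   ≡⟨ regroup (sawProducts a) (+ suc q) ⟩
    + 12 * sawProducts a * + suc q          ≡⟨ ℚᵘ.drop-*≡* 12W/4b²≃k/q ⟩
    k * + (1 ℕ.* (2 ℕ.* b ℕ.* (2 ℕ.* b)))   ≡⟨ cong (k *_) (trans (cong +_ (square-of-double n)) (ℤ.pos-* 4 (b ℕ.* b))) ⟩
    k * (+ 4 * + (b ℕ.* b))                 ≡⟨ cong (λ t → k * (+ 4 * t)) (ℤ.pos-* b b) ⟩
    k * (+ 4 * (+ b * + b))                 ≡⟨ regroup′ k (+ b) ⟩
    + 4 * (k * (+ b * + b))                 ∎)
    where
    open ≡-Reasoning
    12W/4b²≃k/q : mkℚᵘ (+ 12 * sawProducts a) (ℕ.pred (1 ℕ.* suc 4b²-1)) ≃ mkℚᵘ k q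
    12W/4b²≃k/q = ℚᵘ.≃-trans (ℚᵘ.≃-sym (normDedekind≃sawProducts a))
                    (ℚᵘ.≃-trans (ℚᵘ.≃-reflexive (cong toℚᵘ S≡k/q)) (ℚ.toℚᵘ-fromℚᵘ (mkℚᵘ k q)))
    regroup : ∀ W q → + 4 * (+ 3 * W * q) ≡ + 12 * W * q
    regroup = solve-∀
    square-of-double : ∀ n → 1 ℕ.* (2 ℕ.* suc n ℕ.* (2 ℕ.* suc n)) ≡ 4 ℕ.* (suc n ℕ.* suc n)
    square-of-double = ℕ-solve-∀
    regroup′ : ∀ k b → k * (+ 4 * (b * b)) ≡ + 4 * (k * (b * b))
    regroup′ = solve-∀

-- Dedekind sums as integers

-- b · S(a,b), where U = Σ_{0<j<b} j ⌊aj/b⌋.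
dedekindNumerator : ℤ → ℤ → ℤ → ℤ
dedekindNumerator a b U = + 2 * a * (b - + 1) * (+ 2 * b - + 1) - + 3 * b * (b - + 1) - + 12 * U

-- (a · b·S(a,b) − a² − 1)/b, where X = Σ_{0<j<b} ⌊aj/b⌋ (⌊aj/b⌋ − 1)/2.
reciprocityQuotient : ℤ → ℤ → ℤ → ℤ
reciprocityQuotient a b X = (a * a + + 1) * (+ 2 * b - + 3) - + 3 * (b - + 1) * (+ 2 * a - + 1) - + 12 * X

module _ (a : ℤ) (n : ℕ) (a⊥b : gcd a (+ suc n) ≡ + 1) where

  private
    b : ℕ
    b = suc n

    b⊥a : ℤ.Coprime (+ b) a
    b⊥a = ℕ.sym (ℕ.gcd≡1⇒coprime (ℤ.+-injective a⊥b))

  residue-of : ℕ → ℕ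
  residue-of j = (a * + j) %ℕ b

  quotient-of : ℕ → ℤ
  quotient-of j = (a * + j) /ℕ b

  residue-of≡ : ∀ j → + residue-of j ≡ a * + j - quotient-of j * + b
  residue-of≡ j = trans (sub-add (+ residue-of j) (quotient-of j * + b))
                        (cong (_- quotient-of j * + b) (sym (a≡a%ℕn+[a/ℕn]*n (a * + j) b)))
    where
    sub-add : ∀ r t → r ≡ r + t - t
    sub-add = solve-∀

  private
    a*j≡residue : ∀ j → a * + j ≡ + residue-of j mod + b
    a*j≡residue j = ≡-mod-%ℕ (a * + j) b

    residue-of-injective : ∀ {i j} → i ℕ.≤ n → j ℕ.≤ n → residue-of i ≡ residue-of j → i ≡ j
    residue-of-injective {i} {j} i≤n j≤n ri≡rj = residue-unique i≡j-mod-b (s≤s i≤n) (s≤s j≤n)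
      where
      i≡j-mod-b : + i ≡ + j mod + b
      i≡j-mod-b = coprime-cancel-mod {a = a} b⊥a
        (≡-mod-trans (a*j≡residue i) (subst (λ r → + r ≡ a * + j mod + b) (sym ri≡rj) (≡-mod-sym (a*j≡residue j))))

  residue-of-into : ∀ {j} → 1 ℕ.≤ j → j ℕ.≤ n → 1 ℕ.≤ residue-of j × residue-of j ℕ.≤ n
  residue-of-into {j} 1≤j j≤n = nonzero (residue-of j) refl , ℕ.≤-pred (n%ℕd<d (a * + j) b)
    where
    nonzero : ∀ r → residue-of j ≡ r → 1 ℕ.≤ r
    nonzero (suc _) _ = s≤s z≤n
    nonzero zero rj≡0 =
      contradiction (residue-of-injective z≤n j≤n (trans (cong (_%ℕ b) (ℤ.*-zeroʳ a)) (sym rj≡0))) (ℕ.<⇒≢ 1≤j)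

  private
    Q = quotient-of
    r = residue-of
    S₁ = ∑ n (λ j → + j)
    S₂ = ∑ n (λ j → + j * + j)
    U = ∑ n (λ j → + j * Q j)
    V = ∑ n Q

    ∑-residues : ∑ n (λ j → + r j) ≡ S₁
    ∑-residues = ∑-permute residue-of-into (λ _ i≤n _ j≤n → residue-of-injective i≤n j≤n) (λ x → + x)

    ∑-residues² : ∑ n (λ j → + r j * + r j) ≡ S₂
    ∑-residues² = ∑-permute residue-of-into (λ _ i≤n _ j≤n → residue-of-injective i≤n j≤n) (λ x → + x * + x)

    ∑-residues≡aS₁-bV : ∑ n (λ j → + r j) ≡ a * S₁ + - + b * V
    ∑-residues≡aS₁-bV = trans (∑-cong n (λ {j} _ _ → trans (residue-of≡ j) (expand a (+ j) (Q j) (+ b))))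
                              (∑-linear n a (- + b) (λ j → + j) Q)
      where
      expand : ∀ a j q b → a * j - q * b ≡ a * j + - b * q
      expand = solve-∀

    ∑-j*residue : ∑ n (λ j → + j * + r j) ≡ a * S₂ + - + b * U
    ∑-j*residue = trans (∑-cong n (λ {j} _ _ → trans (cong (+ j *_) (residue-of≡ j)) (expand a (+ j) (Q j) (+ b))))
                        (∑-linear n a (- + b) (λ j → + j * + j) (λ j → + j * Q j))
      where
      expand : ∀ a j q b → j * (a * j - q * b) ≡ a * (j * j) + - b * (j * q)
      expand = solve-∀

    Y = ∑ n (λ j → Q j * Q j)

    ∑-residues²≡ : ∑ n (λ j → + r j * + r j) ≡ (a * a) * S₂ + - (+ 2 * a * + b) * U + (+ b * + b) * Y
    ∑-residues²≡ = begin
      ∑ n (λ j → + r j * + r j)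
        ≡⟨ ∑-cong n (λ {j} _ _ → trans (cong₂ _*_ (residue-of≡ j) (residue-of≡ j)) (expand a (+ j) (Q j) (+ b))) ⟩
      ∑ n (λ j → ((a * a) * (+ j * + j) + - (+ 2 * a * + b) * (+ j * Q j)) + (+ b * + b) * (Q j * Q j))
        ≡⟨ ∑-distrib-+ n (λ j → (a * a) * (+ j * + j) + - (+ 2 * a * + b) * (+ j * Q j))
                         (λ j → (+ b * + b) * (Q j * Q j)) ⟩
      ∑ n (λ j → (a * a) * (+ j * + j) + - (+ 2 * a * + b) * (+ j * Q j)) + ∑ n (λ j → (+ b * + b) * (Q j * Q j))
        ≡⟨ cong₂ _+_ (∑-linear n (a * a) (- (+ 2 * a * + b)) (λ j → + j * + j) (λ j → + j * Q j))
                     (∑-*ˡ n (+ b * + b) (λ j → Q j * Q j)) ⟩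
      (a * a) * S₂ + - (+ 2 * a * + b) * U + (+ b * + b) * Y ∎
      where
      open ≡-Reasoning
      expand : ∀ a j q b → (a * j - q * b) * (a * j - q * b) ≡
                           (a * a) * (j * j) + - (+ 2 * a * b) * (j * q) + (b * b) * (q * q)
      expand = solve-∀

    triangular : ℕ → ℤ
    triangular j = proj₁ (≡-mod⇒≡+multiple (consecutive-product-even (Q j - + 1)))

    Q²≡Q+2x : ∀ j → Q j * Q j ≡ Q j + + 2 * triangular j
    Q²≡Q+2x j = trans (split (Q j)) (cong (_+_ (Q j)) (trans (proj₂ (≡-mod⇒≡+multiple (consecutive-product-even (Q j - + 1))))
                                                              (sym (double-comm (triangular j)))))
      where
      split : ∀ q → q * q ≡ q + (q - + 1) * ((q - + 1) + + 1)
      split = solve-∀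
      double-comm : ∀ x → + 2 * x ≡ + 0 + x * + 2
      double-comm = solve-∀

    X = ∑ n triangular

    Y≡V+2X : Y ≡ V + + 2 * X
    Y≡V+2X = trans (∑-cong n (λ {j} _ _ → trans (Q²≡Q+2x j) (cong (_+ + 2 * triangular j) (sym (ℤ.*-identityˡ (Q j))))))
                   (trans (∑-linear n (+ 1) (+ 2) Q triangular) (cong (_+ + 2 * X) (ℤ.*-identityˡ V)))

    2V≡[a-1]n : + 2 * V ≡ (a - + 1) * + n
    2V≡[a-1]n = ℤ.*-cancelˡ-≡ (+ b) _ _ (begin
      + b * (+ 2 * V)                                        ≡⟨ regroup a (+ b) S₁ V ⟩
      (a - + 1) * (+ 2 * S₁) + + 2 * (S₁ - (a * S₁ + - + b * V)) ≡⟨ cong (λ t → (a - + 1) * (+ 2 * S₁) + + 2 * (S₁ - t))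
                                                                   (trans (sym ∑-residues≡aS₁-bV) ∑-residues) ⟩
      (a - + 1) * (+ 2 * S₁) + + 2 * (S₁ - S₁)                  ≡⟨ cong (λ t → (a - + 1) * t + + 2 * (S₁ - S₁))
                                                                   (sum-of-integers n) ⟩
      (a - + 1) * (+ n * (+ n + + 1)) + + 2 * (S₁ - S₁)         ≡⟨ collect a (+ n) S₁ ⟩
      + b * ((a - + 1) * + n)                                  ∎)
      where
      open ≡-Reasoning
      regroup : ∀ a b S V → b * (+ 2 * V) ≡ (a - + 1) * (+ 2 * S) + + 2 * (S - (a * S + - b * V))
      regroup = solve-∀
      collect : ∀ a n S → (a - + 1) * (n * (n + + 1)) + + 2 * (S - S) ≡ (+ 1 + n) * ((a - + 1) * n)
      collect = solve-∀

    12aU≡ : + 12 * a * U ≡ (a * a - + 1) * + n * (+ 2 * + b - + 1) + + 6 * + b * Y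
    12aU≡ = ℤ.*-cancelˡ-≡ (+ b) _ _ (begin
      + b * (+ 12 * a * U)
        ≡⟨ regroup a (+ b) S₂ U Y ⟩
      (a * a - + 1) * (+ 6 * S₂) + + 6 * (+ b * + b) * Y
        - + 6 * ((a * a) * S₂ + - (+ 2 * a * + b) * U + (+ b * + b) * Y - S₂)
        ≡⟨ cong (λ t → (a * a - + 1) * (+ 6 * S₂) + + 6 * (+ b * + b) * Y - + 6 * (t - S₂))
                (trans (sym ∑-residues²≡) ∑-residues²) ⟩
      (a * a - + 1) * (+ 6 * S₂) + + 6 * (+ b * + b) * Y - + 6 * (S₂ - S₂)
        ≡⟨ cong (λ t → (a * a - + 1) * t + + 6 * (+ b * + b) * Y - + 6 * (S₂ - S₂)) (sum-of-squares n) ⟩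
      (a * a - + 1) * (+ n * (+ n + + 1) * (+ 2 * + n + + 1)) + + 6 * (+ b * + b) * Y - + 6 * (S₂ - S₂)
        ≡⟨ collect a (+ n) S₂ Y ⟩
      + b * ((a * a - + 1) * + n * (+ 2 * + b - + 1) + + 6 * + b * Y) ∎)
      where
      open ≡-Reasoning
      regroup : ∀ a b S U Y → b * (+ 12 * a * U) ≡ (a * a - + 1) * (+ 6 * S) + + 6 * (b * b) * Y
                                - + 6 * ((a * a) * S + - (+ 2 * a * b) * U + (b * b) * Y - S)
      regroup = solve-∀
      collect : ∀ a n S Y → (a * a - + 1) * (n * (n + + 1) * (+ 2 * n + + 1)) + + 6 * ((+ 1 + n) * (+ 1 + n)) * Y
                              - + 6 * (S - S) ≡
                            (+ 1 + n) * ((a * a - + 1) * n * (+ 2 * (+ 1 + n) - + 1) + + 6 * (+ 1 + n) * Y)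
      collect = solve-∀

  reciprocity : a * dedekindNumerator a (+ b) U ≡ a * a + + 1 + + b * reciprocityQuotient a (+ b) X
  reciprocity = begin
    a * dedekindNumerator a (+ b) U
      ≡⟨ regroup a (+ n) U V X ⟩
    a * a + + 1 + + b * reciprocityQuotient a (+ b) X
      - (+ 12 * a * U - ((a * a - + 1) * + n * (+ 2 * + b - + 1) + + 6 * + b * (V + + 2 * X)))
      - + 3 * + b * (+ 2 * V - (a - + 1) * + n)
      ≡⟨ cong₂ (λ s t → a * a + + 1 + + b * reciprocityQuotient a (+ b) X
                         - (s - ((a * a - + 1) * + n * (+ 2 * + b - + 1) + + 6 * + b * (V + + 2 * X)))
                         - + 3 * + b * (t - (a - + 1) * + n))
               (trans 12aU≡ (cong (λ y → (a * a - + 1) * + n * (+ 2 * + b - + 1) + + 6 * + b * y) Y≡V+2X))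
               2V≡[a-1]n ⟩
    a * a + + 1 + + b * reciprocityQuotient a (+ b) X
      - (((a * a - + 1) * + n * (+ 2 * + b - + 1) + + 6 * + b * (V + + 2 * X))
         - ((a * a - + 1) * + n * (+ 2 * + b - + 1) + + 6 * + b * (V + + 2 * X)))
      - + 3 * + b * ((a - + 1) * + n - (a - + 1) * + n)
      ≡⟨ cancel (a * a + + 1 + + b * reciprocityQuotient a (+ b) X)
                ((a * a - + 1) * + n * (+ 2 * + b - + 1) + + 6 * + b * (V + + 2 * X)) ((a - + 1) * + n) (+ b) ⟩
    a * a + + 1 + + b * reciprocityQuotient a (+ b) X ∎
    where
    open ≡-Reasoning
    regroup : ∀ a n U V X → let b = + 1 + n in
      a * (+ 2 * a * (b - + 1) * (+ 2 * b - + 1) - + 3 * b * (b - + 1) - + 12 * U) ≡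
      a * a + + 1 + b * ((a * a + + 1) * (+ 2 * b - + 3) - + 3 * (b - + 1) * (+ 2 * a - + 1) - + 12 * X)
        - (+ 12 * a * U - ((a * a - + 1) * n * (+ 2 * b - + 1) + + 6 * b * (V + + 2 * X)))
        - + 3 * b * (+ 2 * V - (a - + 1) * n)
    regroup = solve-∀
    cancel : ∀ x p q b → x - (p - p) - + 3 * b * (q - q) ≡ x
    cancel = solve-∀

  dedekind×4b² : ℤ
  dedekind×4b² = ∑ n (λ j → (+ 2 * + j - + b) * (+ 2 * + r j - + b))

  private
    dedekind×4b²≡ : dedekind×4b² ≡ + 4 * ∑ n (λ j → + j * + r j) + - (+ 2 * + b) * (S₁ + S₁) + + n * (+ b * + b)
    dedekind×4b²≡ = begin
      dedekind×4b²
        ≡⟨ ∑-cong n (λ {j} _ _ → expand (+ j) (+ r j) (+ b)) ⟩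
      ∑ n (λ j → (+ 4 * (+ j * + r j) + - (+ 2 * + b) * (+ j + + r j)) + + b * + b)
        ≡⟨ ∑-distrib-+ n (λ j → + 4 * (+ j * + r j) + - (+ 2 * + b) * (+ j + + r j)) (λ _ → + b * + b) ⟩
      ∑ n (λ j → + 4 * (+ j * + r j) + - (+ 2 * + b) * (+ j + + r j)) + ∑ n (λ _ → + b * + b)
        ≡⟨ cong₂ _+_ (∑-linear n (+ 4) (- (+ 2 * + b)) (λ j → + j * + r j) (λ j → + j + + r j)) (∑-const n (+ b * + b)) ⟩
      + 4 * ∑ n (λ j → + j * + r j) + - (+ 2 * + b) * ∑ n (λ j → + j + + r j) + + n * (+ b * + b)
        ≡⟨ cong (λ t → + 4 * ∑ n (λ j → + j * + r j) + - (+ 2 * + b) * t + + n * (+ b * + b))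
                (trans (∑-distrib-+ n (λ j → + j) (λ j → + r j)) (cong (_+_ S₁) ∑-residues)) ⟩
      + 4 * ∑ n (λ j → + j * + r j) + - (+ 2 * + b) * (S₁ + S₁) + + n * (+ b * + b) ∎
      where
      open ≡-Reasoning
      expand : ∀ j r b → (+ 2 * j - b) * (+ 2 * r - b) ≡ + 4 * (j * r) + - (+ 2 * b) * (j + r) + b * b
      expand = solve-∀

  3*dedekind×4b²≡b*numerator : + 3 * dedekind×4b² ≡ + b * dedekindNumerator a (+ b) U
  3*dedekind×4b²≡b*numerator = begin
    + 3 * dedekind×4b²
      ≡⟨ cong (+ 3 *_) (trans dedekind×4b²≡
           (cong (λ t → + 4 * t + - (+ 2 * + b) * (S₁ + S₁) + + n * (+ b * + b)) ∑-j*residue)) ⟩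
    + 3 * (+ 4 * (a * S₂ + - + b * U) + - (+ 2 * + b) * (S₁ + S₁) + + n * (+ b * + b))
      ≡⟨ regroup a (+ n) U S₁ S₂ ⟩
    + b * dedekindNumerator a (+ b) U + + 2 * a * (+ 6 * S₂ - + n * (+ n + + 1) * (+ 2 * + n + + 1))
      - + 6 * + b * (+ 2 * S₁ - + n * (+ n + + 1))
      ≡⟨ cong₂ (λ s t → + b * dedekindNumerator a (+ b) U + + 2 * a * (s - + n * (+ n + + 1) * (+ 2 * + n + + 1))
                          - + 6 * + b * (t - + n * (+ n + + 1))) (sum-of-squares n) (sum-of-integers n) ⟩
    + b * dedekindNumerator a (+ b) U + + 2 * a * (+ n * (+ n + + 1) * (+ 2 * + n + + 1) - + n * (+ n + + 1) * (+ 2 * + n + + 1))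
      - + 6 * + b * (+ n * (+ n + + 1) - + n * (+ n + + 1))
      ≡⟨ cancel (+ b * dedekindNumerator a (+ b) U) a (+ b) (+ n * (+ n + + 1) * (+ 2 * + n + + 1)) (+ n * (+ n + + 1)) ⟩
    + b * dedekindNumerator a (+ b) U ∎
    where
    open ≡-Reasoning
    regroup : ∀ a n U S₁ S₂ → let b = + 1 + n in
      + 3 * (+ 4 * (a * S₂ + - b * U) + - (+ 2 * b) * (S₁ + S₁) + n * (b * b)) ≡
      b * (+ 2 * a * (b - + 1) * (+ 2 * b - + 1) - + 3 * b * (b - + 1) - + 12 * U)
        + + 2 * a * (+ 6 * S₂ - n * (n + + 1) * (+ 2 * n + + 1)) - + 6 * b * (+ 2 * S₁ - n * (n + + 1))
    regroup = solve-∀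
    cancel : ∀ x a b p q → x + + 2 * a * (p - p) - + 6 * b * (q - q) ≡ x
    cancel = solve-∀




  sawProducts≡dedekind×4b² : sawProducts n a ≡ dedekind×4b²
  sawProducts≡dedekind×4b² = begin
    ∑ n (λ j → sawNumerator b (j ℕ.% b) * sawNumerator b (r j)) + sawNumerator b (b ℕ.% b) * sawNumerator b (r b)
      ≡⟨ cong₂ _+_ (∑-cong n inner-term) (cong (λ t → sawNumerator b t * sawNumerator b (r b)) (n%n≡0 b)) ⟩
    dedekind×4b² + + 0 * sawNumerator b (r b)
      ≡⟨ ℤ.+-identityʳ dedekind×4b² ⟩
    dedekind×4b² ∎
    where
    open ≡-Reasoning
    inner-term : ∀ {j} → 1 ℕ.≤ j → j ℕ.≤ n →
                 sawNumerator b (j ℕ.% b) * sawNumerator b (r j) ≡ (+ 2 * + j - + b) * (+ 2 * + r j - + b)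
    inner-term {j} 1≤j j≤n = cong₂ _*_
      (trans (cong (sawNumerator b) (m<n⇒m%n≡m (s≤s j≤n))) (sawNumerator-nonzero b 1≤j))
      (sawNumerator-nonzero b (proj₁ (residue-of-into 1≤j j≤n)))

  dedekind-value-identities : ∀ k q → normDedekind a b ≡ k ℚ./ suc q →
    ∃[ U ] ∃[ X ] dedekindNumerator a (+ b) U * + suc q ≡ k * + b
                × a * dedekindNumerator a (+ b) U ≡ a * a + + 1 + + b * reciprocityQuotient a (+ b) X
  dedekind-value-identities k q S≡k/q = U , X , ℤ.*-cancelˡ-≡ (+ b) _ _ (begin
    + b * (dedekindNumerator a (+ b) U * + suc q)   ≡⟨ ℤ.*-assoc (+ b) (dedekindNumerator a (+ b) U) (+ suc q) ⟨
    + b * dedekindNumerator a (+ b) U * + suc q     ≡⟨ cong (_* + suc q) (sym 3*dedekind×4b²≡b*numerator) ⟩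
    + 3 * dedekind×4b² * + suc q                    ≡⟨ cong (λ t → + 3 * t * + suc q) (sym sawProducts≡dedekind×4b²) ⟩
    + 3 * sawProducts n a * + suc q                 ≡⟨ 3*sawProducts*q≡k*b² n a k q S≡k/q ⟩
    k * (+ b * + b)                                 ≡⟨ regroup k (+ b) ⟩
    + b * (k * + b)                                 ∎) , reciprocity
    where
    open ≡-Reasoning
    regroup : ∀ k b → k * (b * b) ≡ b * (k * b)
    regroup = solve-∀

-- Arithmetic of a value k/q

dedekindNumerator≡0-mod-3 : ∀ a b U → b * b ≡ + 1 mod + 3 → dedekindNumerator a b U ≡ + 0 mod + 3
dedekindNumerator≡0-mod-3 a b U b²≡1 = begin
  dedekindNumerator a b U           ≡⟨ regroup a b U ⟩
  + 4 * a * (b * b - + 1) + + 3 * t ≈⟨ +-cong-mod (*-congˡ-mod {x = + 4 * a} b²-1≡0) (multiple≡0-mod t (+ 3)) ⟩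
  + 4 * a * + 0 + + 0               ≡⟨ trans (ℤ.+-identityʳ _) (ℤ.*-zeroʳ (+ 4 * a)) ⟩
  + 0                               ∎
  where
  open ≡-mod-Reasoning (+ 3)
  t = + 2 * a * (+ 1 - b) - b * (b - + 1) - + 4 * U
  b²-1≡0 : b * b - + 1 ≡ + 0 mod + 3
  b²-1≡0 = +-cong-mod b²≡1 (≡⇒≡-mod {x = - + 1} refl)
  regroup : ∀ a b U → + 2 * a * (b - + 1) * (+ 2 * b - + 1) - + 3 * b * (b - + 1) - + 12 * U ≡
                      + 4 * a * (b * b - + 1) + + 3 * (+ 2 * a * (+ 1 - b) - b * (b - + 1) - + 4 * U)
  regroup = solve-∀

dedekindNumerator≡b-1-mod-4 : ∀ a b U → b ≡ + 1 mod + 2 → dedekindNumerator a b U ≡ b - + 1 mod + 4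
dedekindNumerator≡b-1-mod-4 a b U b-odd with ≡-mod⇒≡+multiple b-odd
... | u , refl = mod∣ (divides (a * u * (+ 2 * (+ 1 + u * + 2) - + 1) - + 2 * u - + 3 * u * u - + 3 * U)
                               (expand a u U))
  where
  expand : ∀ a u U → let b = + 1 + u * + 2 in
           + 2 * a * (b - + 1) * (+ 2 * b - + 1) - + 3 * b * (b - + 1) - + 12 * U - (b - + 1) ≡
                     (a * u * (+ 2 * (+ 1 + u * + 2) - + 1) - + 2 * u - + 3 * u * u - + 3 * U) * + 4
  expand = solve-∀

reciprocityQuotient≡3-mod-4 : ∀ a b X → a ≡ + 1 mod + 2 → b ≡ + 2 mod + 4 → reciprocityQuotient a b X ≡ + 3 mod + 4
reciprocityQuotient≡3-mod-4 a b X a-odd b≡2 with ≡-mod⇒≡+multiple a-odd | ≡-mod⇒≡+multiple b≡2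
... | α , refl | t , refl =
  mod∣ (divides (- + 1 - + 2 * α + α * α + t - + 4 * α * t + + 8 * α * α * t - + 3 * X) (expand α t X))
  where
  expand : ∀ α t X → let a = + 1 + α * + 2; b = + 2 + t * + 4 in
           (a * a + + 1) * (+ 2 * b - + 3) - + 3 * (b - + 1) * (+ 2 * a - + 1) - + 12 * X - + 3 ≡
                     (- + 1 - + 2 * α + α * α + t - + 4 * α * t + + 8 * α * α * t - + 3 * X) * + 4
  expand = solve-∀

k≡q-1-mod-4-from-reciprocity : ∀ {a k D' q F} → a ≡ + 1 mod + 2 → D' ≡ + 1 mod + 4 → q ≡ + 1 mod + 2 →
  F ≡ + 3 mod + 4 → a * (k * (+ 2 * D')) ≡ a * a + + 1 + + 2 * D' * q * F → k ≡ q - + 1 mod + 4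
k≡q-1-mod-4-from-reciprocity {k = k} {D'} {F = F} a-odd D'≡1 q-odd F≡3 akD≡
  with ≡-mod⇒≡+multiple a-odd | ≡-mod⇒≡+multiple q-odd
... | α , refl | s , refl = begin
  k                                         ≡⟨ unit k ⟩
  + 1 * (k * + 1)                           ≈⟨ *-cong-mod (≡-mod-sym a²≡1) (*-congˡ-mod {x = k} (≡-mod-sym D'≡1)) ⟩
  a * a * (k * D')                          ≡⟨ ℤ.*-assoc a a (k * D') ⟩
  a * (a * (k * D'))                        ≡⟨ cong (a *_) akD'≡ ⟩
  a * (+ 1 + β * + 4 + D' * q * F)          ≈⟨ *-congˡ-mod {x = a} (+-cong-mod (≡-mod-multiple (+ 1) β)
                                                 (*-cong-mod (*-congʳ-mod {y = q} D'≡1) F≡3)) ⟩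
  a * (+ 1 + + 1 * q * + 3)                 ≈⟨ mod∣ (divides (+ 1 + s + + 2 * α + + 3 * α * s) (expand α s)) ⟩
  q - + 1                                   ∎
  where
  open ≡-mod-Reasoning (+ 4)
  a = + 1 + α * + 2
  q = + 1 + s * + 2
  β = proj₁ (≡-mod⇒≡+multiple (consecutive-product-even α))
  α[α+1]≡2β : α * (α + + 1) ≡ + 0 + β * + 2
  α[α+1]≡2β = proj₂ (≡-mod⇒≡+multiple (consecutive-product-even α))
  a²≡1 : a * a ≡ + 1 mod + 4
  a²≡1 = ≡-mod-trans (≡⇒≡-mod (square α)) (≡-mod-multiple (+ 1) (α * (α + + 1)))
    where
    square : ∀ α → (+ 1 + α * + 2) * (+ 1 + α * + 2) ≡ + 1 + α * (α + + 1) * + 4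
    square = solve-∀
  -- α(α + 1) = 2β gives a² + 1 = 2(1 + 4β), so the hypothesis can be halved.
  akD'≡ : a * (k * D') ≡ + 1 + β * + 4 + D' * q * F
  akD'≡ = ℤ.*-cancelˡ-≡ (+ 2) _ _
    (trans (double a k D') (trans akD≡ (trans (cong (_+ + 2 * D' * q * F) a²+1≡2[1+4β]) (collect β D' q F))))
    where
    collect : ∀ β D' q F → + 2 * (+ 1 + β * + 4) + + 2 * D' * q * F ≡ + 2 * (+ 1 + β * + 4 + D' * q * F)
    collect = solve-∀
    double : ∀ a k D' → + 2 * (a * (k * D')) ≡ a * (k * (+ 2 * D'))
    double = solve-∀
    square+1 : ∀ α → (+ 1 + α * + 2) * (+ 1 + α * + 2) + + 1 ≡ + 2 + + 4 * (α * (α + + 1))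
    square+1 = solve-∀
    a²+1≡2[1+4β] : a * a + + 1 ≡ + 2 * (+ 1 + β * + 4)
    a²+1≡2[1+4β] = trans (square+1 α) (trans (cong (λ t → + 2 + + 4 * t) α[α+1]≡2β) (halve β))
      where
      halve : ∀ β → + 2 + + 4 * (+ 0 + β * + 2) ≡ + 2 * (+ 1 + β * + 4)
      halve = solve-∀
  unit : ∀ k → k ≡ + 1 * (k * + 1)
  unit = solve-∀
  expand : ∀ α s → (+ 1 + α * + 2) * (+ 1 + + 1 * (+ 1 + s * + 2) * + 3) - ((+ 1 + s * + 2) - + 1) ≡
                   (+ 1 + s + + 2 * α + + 3 * α * s) * + 4
  expand = solve-∀

cofactor-of-coprime : ∀ {k M q b} .{{_ : ℕ.NonZero q}} → gcd k (+ q) ≡ + 1 → M * + q ≡ k * + b →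
                      ∃[ D ] + b ≡ + D * + q × M ≡ k * + D
cofactor-of-coprime {k} {M} {q} {b} k⊥q Mq≡kb = D , b≡Dq , M≡kD
  where
  q∣b : q ℕ.∣ b
  q∣b = ℤ.coprime-divisor (+ q) k (+ b) (ℕ.sym (ℕ.gcd≡1⇒coprime (ℤ.+-injective k⊥q)))
                         (∣⇒∣ᵤ (divides M (sym Mq≡kb)))
  D = ℕ._∣_.quotient q∣b
  b≡Dq : + b ≡ + D * + q
  b≡Dq = trans (cong +_ (ℕ._∣_.equality q∣b)) (ℤ.pos-* D q)
  M≡kD : M ≡ k * + D
  M≡kD = ℤ.*-cancelʳ-≡ M (k * + D) (+ q) (trans Mq≡kb (trans (cong (k *_) b≡Dq) (sym (ℤ.*-assoc k (+ D) (+ q)))))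

module DedekindValue {a k U X : ℤ} {b q D : ℕ} (b≡Dq : + b ≡ + D * + q) (M≡kD : dedekindNumerator a (+ b) U ≡ k * + D)
         (aM≡a²+1+bF : a * dedekindNumerator a (+ b) U ≡ a * a + + 1 + + b * reciprocityQuotient a (+ b) X)
  where

  private
    M = dedekindNumerator a (+ b) U
    F = reciprocityQuotient a (+ b) X
    G = a * k - + q * F

    a²+1≡DG : a * a + + 1 ≡ + D * G
    a²+1≡DG = begin
      a * a + + 1                       ≡⟨ add-sub (a * a + + 1) (+ b * F) ⟩
      a * a + + 1 + + b * F - + b * F   ≡⟨ cong₂ (λ s t → s - t * F) (sym aM≡a²+1+bF) b≡Dq ⟩
      a * M - + D * + q * F             ≡⟨ cong (λ t → a * t - + D * + q * F) M≡kD ⟩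
      a * (k * + D) - + D * + q * F     ≡⟨ factor a k (+ D) (+ q) F ⟩
      + D * (a * k - + q * F)           ∎
      where
      open ≡-Reasoning
      add-sub : ∀ x y → x ≡ x + y - y
      add-sub = solve-∀
      factor : ∀ a k D q F → a * (k * D) - D * q * F ≡ D * (a * k - q * F)
      factor = solve-∀

    a²+1≡0-mod-D : a * a + + 1 ≡ + 0 mod + D
    a²+1≡0-mod-D = ≡-mod-trans (≡⇒≡-mod a²+1≡DG) (multiple≡0-mod _ (+ D))

  k≡0-mod-3 : ¬ (3 ℕ.∣ q) → k ≡ + 0 mod + 3
  k≡0-mod-3 3∤q = begin
    k                   ≡⟨ sym (ℤ.*-identityʳ k) ⟩
    k * + 1             ≈⟨ *-congˡ-mod {x = k} (≡-mod-sym D²≡1) ⟩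
    k * (+ D * + D)     ≡⟨ sym (ℤ.*-assoc k (+ D) (+ D)) ⟩
    k * + D * + D       ≡⟨ cong (_* + D) (sym M≡kD) ⟩
    M * + D             ≈⟨ *-congʳ-mod {y = + D} (dedekindNumerator≡0-mod-3 a (+ b) U b²≡1) ⟩
    + 0 * + D           ≡⟨⟩
    + 0                 ∎
    where
    open ≡-mod-Reasoning (+ 3)
    D²≡1 : + D * + D ≡ + 1 mod + 3
    D²≡1 = square≡1-mod-3 (+ D) λ D≡0 →
      square+1≢0-mod-3 a (≡-mod-weaken (∣ᵤ⇒∣ (≡0-mod⇒∣ D≡0)) a²+1≡0-mod-D)
    b²≡1 : + b * + b ≡ + 1 mod + 3
    b²≡1 = subst (λ t → t * t ≡ + 1 mod + 3) (sym b≡Dq)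
             (≡-mod-trans (≡⇒≡-mod (interchange (+ D) (+ q)))
               (*-cong-mod D²≡1 (square≡1-mod-3 (+ q) (3∤q ∘ ≡0-mod⇒∣))))
      where
      interchange : ∀ D q → D * q * (D * q) ≡ D * D * (q * q)
      interchange = solve-∀

  private
    k≡q-1-mod-4-for-odd-D : + D ≡ + 1 mod + 2 → + q ≡ + 1 mod + 2 → k ≡ + q - + 1 mod + 4
    k≡q-1-mod-4-for-odd-D D-odd q-odd = begin
      k                ≡⟨ sym (ℤ.*-identityʳ k) ⟩
      k * + 1          ≈⟨ *-congˡ-mod {x = k} (≡-mod-sym D≡1) ⟩
      k * + D          ≡⟨ sym M≡kD ⟩
      M                ≈⟨ dedekindNumerator≡b-1-mod-4 a (+ b) U b-odd ⟩
      + b - + 1        ≡⟨ cong (_- + 1) b≡Dq ⟩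
      + D * + q - + 1  ≈⟨ +-cong-mod (*-congʳ-mod {y = + q} D≡1) (≡⇒≡-mod {x = - + 1} refl) ⟩
      + 1 * + q - + 1  ≡⟨ cong (_- + 1) (ℤ.*-identityˡ (+ q)) ⟩
      + q - + 1        ∎
      where
      open ≡-mod-Reasoning (+ 4)
      D≡1 : + D ≡ + 1 mod + 4
      D≡1 = odd∣square+1⇒≡1-mod-4 D a a²+1≡0-mod-D D-odd
      b-odd : + b ≡ + 1 mod + 2
      b-odd = subst (_≡ + 1 mod + 2) (sym b≡Dq) (*-cong-mod D-odd q-odd)

    k≡q-1-mod-4-for-even-D : + D ≡ + 0 mod + 2 → + q ≡ + 1 mod + 2 → k ≡ + q - + 1 mod + 4
    k≡q-1-mod-4-for-even-D D-even q-odd = k≡q-1-mod-4-from-reciprocity a-odd D'≡1 q-odd F≡3 akD≡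
      where
      D' = D ℕ./ 2
      D≡2D' : + D ≡ + 2 * + D'
      D≡2D' = trans (cong +_ (even⇒≡2*half D-even)) (ℤ.pos-* 2 D')
      a-odd : a ≡ + 1 mod + 2
      a-odd = square+1≡0-mod-2⇒odd a (≡-mod-weaken (divides (+ D') (trans D≡2D' (ℤ.*-comm (+ 2) (+ D')))) a²+1≡0-mod-D)
      D'-odd : + D' ≡ + 1 mod + 2
      D'-odd with parity (+ D')
      ... | inj₂ odd  = odd
      ... | inj₁ even = contradiction a²+1≡0-mod-4 (square+1≢0-mod-4 a)
        where
        a²+1≡0-mod-4 : a * a + + 1 ≡ + 0 mod + 4
        a²+1≡0-mod-4 = ≡-mod-trans (≡⇒≡-mod (trans a²+1≡DG (cong (_* G) D≡2D')))
                                   (*-congʳ-mod {y = G} (≡-mod-scale (+ 2) even))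
      D'≡1 : + D' ≡ + 1 mod + 4
      D'≡1 = odd∣square+1⇒≡1-mod-4 D' a (≡-mod-weaken (divides (+ 2) D≡2D') a²+1≡0-mod-D) D'-odd
      b≡2 : + b ≡ + 2 mod + 4
      b≡2 = subst (_≡ + 2 mod + 4) (sym (trans b≡Dq (trans (cong (_* + q) D≡2D') (ℤ.*-assoc (+ 2) (+ D') (+ q)))))
                  (≡-mod-scale (+ 2) (*-cong-mod D'-odd q-odd))
      F≡3 : F ≡ + 3 mod + 4
      F≡3 = reciprocityQuotient≡3-mod-4 a (+ b) X a-odd b≡2
      akD≡ : a * (k * (+ 2 * + D')) ≡ a * a + + 1 + + 2 * + D' * + q * F
      akD≡ = begin
        a * (k * (+ 2 * + D'))       ≡⟨ cong (λ t → a * (k * t)) (sym D≡2D') ⟩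
        a * (k * + D)                ≡⟨ cong (a *_) (sym M≡kD) ⟩
        a * M                        ≡⟨ aM≡a²+1+bF ⟩
        a * a + + 1 + + b * F        ≡⟨ cong (λ t → a * a + + 1 + t * F) (trans b≡Dq (cong (_* + q) D≡2D')) ⟩
        a * a + + 1 + + 2 * + D' * + q * F ∎
        where open ≡-Reasoning

  k≡q-1-mod-4 : + q ≡ + 1 mod + 2 → k ≡ + q - + 1 mod + 4
  k≡q-1-mod-4 with parity (+ D)
  ... | inj₁ D-even = k≡q-1-mod-4-for-even-D D-even
  ... | inj₂ D-odd  = k≡q-1-mod-4-for-odd-D D-odd

proposition1 : (q : ℕ) .{{_ : ℕ.NonZero q}} (k : ℤ) → gcd k (+ q) ≡ + 1 →
    IsNormDedekindValue (k ℚ./ q) →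
    ((¬ (3 ℕ.∣ q) → k %ℕ 3 ≡ 0) × (q ℕ.% 4 ≡ 3 → k %ℕ 4 ≡ 2) × (q ℕ.% 4 ≡ 1 → k %ℕ 4 ≡ 0))
proposition1 q@(suc q-1) k k⊥q (a , suc n , _ , a⊥b , S≡k/q) =
    (λ 3∤q   → %ℕ-unique (k≡0-mod-3 3∤q) (s≤s z≤n))
  , (λ q%4≡3 → %ℕ-unique (k≡r-1 q%4≡3 (≡-mod-multiple (+ 1) (+ 1))) (s≤s (s≤s (s≤s z≤n))))
  , (λ q%4≡1 → %ℕ-unique (k≡r-1 q%4≡1 (≡⇒≡-mod refl)) (s≤s z≤n))
  where
  identities = dedekind-value-identities a n a⊥b k q-1 S≡k/q
  U = proj₁ identities
  X = proj₁ (proj₂ identities)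
  Mq≡kb = proj₁ (proj₂ (proj₂ identities))
  aM≡a²+1+bF = proj₂ (proj₂ (proj₂ identities))
  cofactor = cofactor-of-coprime {k} {q = q} k⊥q Mq≡kb
  open DedekindValue {a} {k} {U} {X} {suc n} {q} {proj₁ cofactor} (proj₁ (proj₂ cofactor)) (proj₂ (proj₂ cofactor)) aM≡a²+1+bF
  k≡r-1 : ∀ {r} → q ℕ.% 4 ≡ r → + r ≡ + 1 mod + 2 → k ≡ + r - + 1 mod + 4
  k≡r-1 {r} q%4≡r r-odd =
    ≡-mod-trans (k≡q-1-mod-4 (≡-mod-4⇒odd q≡r r-odd)) (+-cong-mod q≡r (≡⇒≡-mod {x = - + 1} refl))
    where
    q≡r : + q ≡ + r mod + 4
    q≡r = subst (λ t → + q ≡ + t mod + 4) q%4≡r (≡-mod-%ℕ (+ q) 4)
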